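{- Let $k$ be a commutative unital ring, $A$ a commutative $k$-algebra and $n\geq2$ an integer. Define $D_1^{(n)}:K_1(A;\mathbf Z/n)\to\Omega^1_{dR}(A)/n\Omega^1_{dR}(A)$ by $$D_1^{(n)}([P,\alpha,Q])=\mathrm{tr}\big(\alpha^{ -1}\circ d(\alpha,n\nabla,n\nabla')\big)\bmod n\Omega^1_{dR}(A),$$ where $\nabla,\nabla'$ are connections on $P$ and $Q$. Then $D_1^{(n)}$ is well defined (independent of the choices of connections and of the representative) and is a homomorphism of abelian groups.
   Context: $\Omega^1_{dR}(A)$ is the $A$-module of Kähler differentials of $A$ over $k$ (generated by $da$, $d\lambda=0$ for $\lambda\in k$, $d(ab)=a\,db+b\,da$). For finitely generated projective $A$-modules, a connection on $P$ is an additive map $\nabla:P\to P\otimes_A\Omega^1_{dR}(A)$ with $\nabla(xa)=\nabla(x)a+x\otimes da$. For $\alpha:P\to Q$ $A$-linear and connections $\nabla,\nabla'$, $d(\alpha,\nabla,\nabla')=\nabla'\circ\alpha-(\alpha\otimes\mathrm{id})\circ\nabla$, an $A$-linear map $P\to Q\otimes_A\Omega^1_{dR}(A)$. For an isomorphism $\alpha$, $\alpha^{ -1}\circ d(\alpha,\nabla,\nabla')$ means $(\alpha^{ -1}\otimes\mathrm{id})\circ d(\alpha,\nabla,\nabla'):P\to P\otimes_A\Omega^1_{dR}(A)$, and its trace is $\sum_j(\varphi_j\otimes\mathrm{id})(f(x_j))$ for any coordinate system $(x_j,\varphi_j)$ of $P$ (i.e. $x=\sum_jx_j\varphi_j(x)$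 for all $x$). $nP=P^{\oplus n}$, $n\nabla=\nabla^{\oplus n}$. $K_1(A;\mathbf Z/n)$: triples $(P,\alpha,Q)$ with $P,Q$ finitely generated projective and $\alpha:nP\to nQ$ an isomorphism; isomorphisms of triples are pairs $(f,g)$ of isomorphisms with $ng\circ\alpha=\alpha'\circ nf$; $K_1(A;\mathbf Z/n)$ is the Grothendieck group of isomorphism classes (under $\oplus$) modulo the relations $(P,\alpha,Q)+(Q,\beta,R)=(P,\beta\alpha,R)$; $[P,\alpha,Q]$ is the class. -}

module Defs where

open import Level using (Level; _⊔_) renaming (suc to lsuc)
open import Data.Nat using (ℕ; zero; suc) renaming (_+_ to _+ℕ_)
open import Data.Fin using (Fin; splitAt)
import Data.Fin
open import Data.Sum using (inj₁; inj₂; [_,_])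
open import Data.Product using (Σ; _×_; _,_; proj₁; proj₂)
open import Data.Bool using (Bool; true; false)
open import Data.List using (List; []; _∷_; _++_; map; concat; tabulate)
open import Algebra.Bundles using (CommutativeRing)
open import Algebra.Module.Bundles using (Module)
import Algebra.Module.Construct.Zero as Zero
import Algebra.Module.Construct.DirectProduct as DP
import Algebra.Module.Construct.TensorUnit as TU
open import Algebra.Module.Morphism.Structures using (module ModuleMorphisms)
import Algebra.Module.Morphism.Construct.Composition as Comp

module KD {ck ℓk c ℓ : Level}
          (k : CommutativeRing ck ℓk) (A : CommutativeRing c ℓ)
          (ι : CommutativeRing.Carrier k → CommutativeRing.Carrier A) where

  open CommutativeRing A renaming (Carrier to ∣A∣)

  -- Kähler differentials Ω¹_{dR}(A) over k.
  -- An element is a formal finite sum  Σ aᵢ d bᵢ  (list of pairs (aᵢ , bᵢ)),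
  -- modulo the A-submodule generated by the defining relations.

  ΩC : Set c
  ΩC = List (∣A∣ × ∣A∣)

  infix 4 _≈Ω_
  data _≈Ω_ : ΩC → ΩC → Set (ck ⊔ c ⊔ ℓ) where
    Ω-refl  : ∀ {x} → x ≈Ω x
    Ω-sym   : ∀ {x y} → x ≈Ω y → y ≈Ω x
    Ω-trans : ∀ {x y z} → x ≈Ω y → y ≈Ω z → x ≈Ω z
    Ω-++    : ∀ {x x' y y'} → x ≈Ω x' → y ≈Ω y' → x ++ y ≈Ω x' ++ y'
    Ω-comm  : ∀ x y → x ++ y ≈Ω y ++ x
    Ω-cong  : ∀ {a a' b b'} → a ≈ a' → b ≈ b' → (a , b) ∷ [] ≈Ω (a' , b') ∷ []
    Ω-addˡ  : ∀ a a' b → (a + a' , b) ∷ [] ≈Ω (a , b) ∷ (a' , b) ∷ []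
    Ω-zeroˡ : ∀ b → (0# , b) ∷ [] ≈Ω []
    Ω-addʳ  : ∀ a b b' → (a , b + b') ∷ [] ≈Ω (a , b) ∷ (a , b') ∷ []
    Ω-leib  : ∀ a b b' → (a , b * b') ∷ [] ≈Ω (a * b , b') ∷ (a * b' , b) ∷ []
    Ω-const : ∀ a λ' → (a , ι λ') ∷ [] ≈Ω []

  d : ∣A∣ → ΩC
  d b = (1# , b) ∷ []

  _·Ω_ : ∣A∣ → ΩC → ΩC
  r ·Ω ω = map (λ p → (r * proj₁ p , proj₂ p)) ω

  nTimes : ℕ → ΩC → ΩC
  nTimes zero    ω = []
  nTimes (suc n) ω = ω ++ nTimes n ω

  _≈[mod_]_ : ΩC → ℕ → ΩC → Set (ck ⊔ c ⊔ ℓ)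
  x ≈[mod n ] y = Σ ΩC λ z → x ≈Ω y ++ nTimes n z

  -- The tensor product M ⊗_A Ω¹ for an A-module M, presented as formal
  -- finite sums of elementary tensors modulo the bilinearity / balancing
  -- relations.

  module _ {m ℓm : Level} (M : Module A m ℓm) where
    open Module M

    TensorC : Set (m ⊔ c)
    TensorC = List (Carrierᴹ × ΩC)

    data _≈⊗_ : TensorC → TensorC → Set (ck ⊔ c ⊔ ℓ ⊔ m ⊔ ℓm) where
      ⊗-refl  : ∀ {x} → x ≈⊗ x
      ⊗-sym   : ∀ {x y} → x ≈⊗ y → y ≈⊗ x
      ⊗-trans : ∀ {x y z} → x ≈⊗ y → y ≈⊗ z → x ≈⊗ z
      ⊗-++    : ∀ {x x' y y'} → x ≈⊗ x' → y ≈⊗ y' → (x ++ y) ≈⊗ (x' ++ y')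
      ⊗-comm  : ∀ x y → (x ++ y) ≈⊗ (y ++ x)
      ⊗-cong  : ∀ {p p' ω ω'} → p ≈ᴹ p' → ω ≈Ω ω' → ((p , ω) ∷ []) ≈⊗ ((p' , ω') ∷ [])
      ⊗-addˡ  : ∀ p p' ω → ((p +ᴹ p' , ω) ∷ []) ≈⊗ ((p , ω) ∷ (p' , ω) ∷ [])
      ⊗-zeroˡ : ∀ ω → ((0ᴹ , ω) ∷ []) ≈⊗ []
      ⊗-addʳ  : ∀ p ω ω' → ((p , ω ++ ω') ∷ []) ≈⊗ ((p , ω) ∷ (p , ω') ∷ [])
      ⊗-zeroʳ : ∀ p → ((p , []) ∷ []) ≈⊗ []
      ⊗-bal   : ∀ a p ω → ((p *ᵣ a , ω) ∷ []) ≈⊗ ((p , a ·Ω ω) ∷ [])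

    _·⊗_ : TensorC → ∣A∣ → TensorC
    t ·⊗ a = map (λ q → (proj₁ q , a ·Ω proj₂ q)) t

    neg⊗ : TensorC → TensorC
    neg⊗ t = map (λ q → (-ᴹ proj₁ q , proj₂ q)) t

    record Connection : Set (ck ⊔ c ⊔ ℓ ⊔ m ⊔ ℓm) where
      field
        ∇       : Carrierᴹ → TensorC
        ∇-cong  : ∀ {x y} → x ≈ᴹ y → ∇ x ≈⊗ ∇ y
        ∇-add   : ∀ x y → ∇ (x +ᴹ y) ≈⊗ (∇ x ++ ∇ y)
        ∇-leib  : ∀ x a → ∇ (x *ᵣ a) ≈⊗ ((∇ x ·⊗ a) ++ ((x , d a) ∷ []))

    record RawCoord : Set (m ⊔ c) where
      field
        len : ℕ
        xs  : Fin len → Carrierᴹ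
        φs  : Fin len → Carrierᴹ → ∣A∣

    sumᴹ : ∀ {l} → (Fin l → Carrierᴹ) → Carrierᴹ
    sumᴹ {zero}  f = 0ᴹ
    sumᴹ {suc l} f = f Data.Fin.zero +ᴹ sumᴹ (λ j → f (Data.Fin.suc j))

    -- finitely generated projective: existence of a coordinate system
    record IsFGP : Set (c ⊔ ℓ ⊔ m ⊔ ℓm) where
      field
        coord : RawCoord
      open RawCoord coord public
      field
        φ-linear : ∀ j → ModuleMorphisms.IsModuleHomomorphism
                           rawModule (Module.rawModule (TU.⟨module⟩ {R = A})) (φs j)
        dual     : ∀ x → x ≈ᴹ sumᴹ (λ j → xs j *ᵣ φs j x)

    tr : RawCoord → (Carrierᴹ → TensorC) → ΩC
    tr rc f = concat (tabulate (λ j → concat (map (λ q → φs j (proj₁ q) ·Ω proj₂ q) (f (xs j)))))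
      where open RawCoord rc

  map⊗ : ∀ {m ℓm m' ℓm'} {M : Module A m ℓm} {N : Module A m' ℓm'} →
         (Module.Carrierᴹ M → Module.Carrierᴹ N) → TensorC M → TensorC N
  map⊗ f t = map (λ q → (f (proj₁ q) , proj₂ q)) t

  _⊕_ : ∀ {m ℓm} → Module A m ℓm → Module A m ℓm → Module A m ℓm
  M ⊕ N = DP.⟨module⟩ M N

  power : ∀ {m ℓm} → ℕ → Module A m ℓm → Module A m ℓm
  power {m} {ℓm} zero    M = Zero.⟨module⟩ {m} {ℓm} {R = A}
  power          (suc n) M = M ⊕ power n M

  powMap : ∀ {m ℓm} (n : ℕ) {M N : Module A m ℓm} →
           (Module.Carrierᴹ M → Module.Carrierᴹ N) →
           Module.Carrierᴹ (power n M) → Module.Carrierᴹ (power n N)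
  powMap zero    f x       = x
  powMap (suc n) f (a , b) = f a , powMap n f b

  pow∇ : ∀ {m ℓm} (n : ℕ) {M : Module A m ℓm} →
         (Module.Carrierᴹ M → TensorC M) →
         Module.Carrierᴹ (power n M) → TensorC (power n M)
  pow∇ zero    ∇ x       = []
  pow∇ (suc n) {M} ∇ (a , b) =
    map (λ q → ((proj₁ q , Module.0ᴹ (power n M)) , proj₂ q)) (∇ a) ++
    map (λ q → ((Module.0ᴹ M , proj₁ q) , proj₂ q)) (pow∇ n ∇ b)

  powCoord : ∀ {m ℓm} (n : ℕ) {M : Module A m ℓm} → RawCoord M → RawCoord (power n M)
  powCoord zero    rc = record { len = 0 ; xs = λ () ; φs = λ () }
  powCoord (suc n) {M} rc = record
    { len = len +ℕ R.len
    ; xs  = λ i → [ (λ j → (xs j , Module.0ᴹ (power n M))) , (λ j → (Module.0ᴹ M , R.xs j)) ] (splitAt len i)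
    ; φs  = λ i → [ (λ j v → φs j (proj₁ v)) , (λ j v → R.φs j (proj₂ v)) ] (splitAt len i)
    }
    where open RawCoord rc
          module R = RawCoord (powCoord n rc)

  unzipPow : ∀ {m ℓm} (n : ℕ) {M M' : Module A m ℓm} →
             Module.Carrierᴹ (power n (M ⊕ M')) →
             Module.Carrierᴹ (power n M) × Module.Carrierᴹ (power n M')
  unzipPow zero    x             = x , x
  unzipPow (suc n) ((a , a') , b) = let r = unzipPow n b in (a , proj₁ r) , (a' , proj₂ r)

  zipPow : ∀ {m ℓm} (n : ℕ) {M M' : Module A m ℓm} →
           Module.Carrierᴹ (power n M) → Module.Carrierᴹ (power n M') →
           Module.Carrierᴹ (power n (M ⊕ M'))
  zipPow zero    x       y        = x
  zipPow (suc n) (a , b) (a' , b') = (a , a') , zipPow n b b'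

  module _ (m ℓm : Level) (n : ℕ) where

    IsIso : (M N : Module A m ℓm) → (Module.Carrierᴹ M → Module.Carrierᴹ N) → Set (c ⊔ m ⊔ ℓm)
    IsIso M N f = ModuleMorphisms.IsModuleIsomorphism (Module.rawModule M) (Module.rawModule N) f

    record Triple : Set (c ⊔ ℓ ⊔ lsuc (m ⊔ ℓm)) where
      constructor triple
      field
        P   : Module A m ℓm
        Q   : Module A m ℓm
        Pfg : IsFGP P
        Qfg : IsFGP Q
        α   : Module.Carrierᴹ (power n P) → Module.Carrierᴹ (power n Q)
        α-iso : IsIso (power n P) (power n Q) α

      α⁻¹ : Module.Carrierᴹ (power n Q) → Module.Carrierᴹ (power n P)
      α⁻¹ y = proj₁ (ModuleMorphisms.IsModuleIsomorphism.surjective α-iso y)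

    record TripleIso (T T' : Triple) : Set (c ⊔ m ⊔ ℓm) where
      module T  = Triple T
      module T' = Triple T'
      field
        f     : Module.Carrierᴹ T.P → Module.Carrierᴹ T'.P
        f-iso : IsIso T.P T'.P f
        g     : Module.Carrierᴹ T.Q → Module.Carrierᴹ T'.Q
        g-iso : IsIso T.Q T'.Q g
        comm  : ∀ x → Module._≈ᴹ_ (power n T'.Q) (powMap n g (T.α x)) (T'.α (powMap n f x))

    sumFun : (T T' : Triple) →
             Module.Carrierᴹ (power n (Triple.P T ⊕ Triple.P T')) →
             Module.Carrierᴹ (power n (Triple.Q T ⊕ Triple.Q T'))
    sumFun T T' x = let r = unzipPow n x in zipPow n (Triple.α T (proj₁ r)) (Triple.α T' (proj₂ r))

    -- free abelian group on triples: signed formal sums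
    K1C : Set (c ⊔ ℓ ⊔ lsuc (m ⊔ ℓm))
    K1C = List (Bool × Triple)

    [_] : Triple → K1C
    [ T ] = (true , T) ∷ []

    infix 4 _~K_
    data _~K_ : K1C → K1C → Set (c ⊔ ℓ ⊔ lsuc (m ⊔ ℓm)) where
      K-refl  : ∀ {x} → x ~K x
      K-sym   : ∀ {x y} → x ~K y → y ~K x
      K-trans : ∀ {x y z} → x ~K y → y ~K z → x ~K z
      K-++    : ∀ {x x' y y'} → x ~K x' → y ~K y' → x ++ y ~K x' ++ y'
      K-comm  : ∀ x y → x ++ y ~K y ++ x
      K-inv   : ∀ T → (true , T) ∷ (false , T) ∷ [] ~K []
      K-iso   : ∀ {T T'} → TripleIso T T' → [ T ] ~K [ T' ]
      K-sum   : ∀ T T' (pf : IsFGP (Triple.P T ⊕ Triple.P T')) (qf : IsFGP (Triple.Q T ⊕ Triple.Q T'))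
                  (iso : IsIso (power n (Triple.P T ⊕ Triple.P T')) (power n (Triple.Q T ⊕ Triple.Q T')) (sumFun T T')) →
                  [ triple _ _ pf qf (sumFun T T') iso ] ~K [ T ] ++ [ T' ]
      K-comp  : ∀ (P Q R : Module A m ℓm) (pf : IsFGP P) (qf qf' : IsFGP Q) (rf : IsFGP R)
                  (α : Module.Carrierᴹ (power n P) → Module.Carrierᴹ (power n Q))
                  (αi : IsIso (power n P) (power n Q) α)
                  (β : Module.Carrierᴹ (power n Q) → Module.Carrierᴹ (power n R))
                  (βi : IsIso (power n Q) (power n R) β) →
                  (true , triple P Q pf qf α αi) ∷ (true , triple Q R qf' rf β βi) ∷ []
                    ~K [ triple P R pf rf (λ x → β (α x))
                           (Comp.isModuleIsomorphism (Module.≈ᴹ-trans (power n R)) αi βi) ]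

    dα : (T : Triple) → Connection (Triple.P T) → Connection (Triple.Q T) →
         Module.Carrierᴹ (power n (Triple.P T)) → TensorC (power n (Triple.Q T))
    dα T ∇ ∇' x =
      pow∇ n (Connection.∇ ∇') (α x) ++
      neg⊗ (power n Q) (map⊗ {M = power n P} {N = power n Q} α (pow∇ n (Connection.∇ ∇) x))
      where open Triple T

    D-formula : (T : Triple) → Connection (Triple.P T) → Connection (Triple.Q T) → ΩC
    D-formula T ∇ ∇' =
      tr (power n P) (powCoord n (IsFGP.coord Pfg))
         (λ x → map⊗ {M = power n Q} {N = power n P} α⁻¹ (dα T ∇ ∇' x))
      where open Triple T

{-# OPTIONS --safe #-}
module Submission where

-- For an isomorphism α : M ≅ N of finitely generated projective modules with connections ∇, ∇′,
-- dlog = α⁻¹ ∘ d(α, ∇, ∇′) = α⁻¹ ∇′ α − ∇ is A-linear and so has a trace in Ω. Replacing ∇, ∇′ by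
-- ∇₂, ∇₂′ adds α⁻¹ (∇₂′ − ∇′) α − (∇₂ − ∇) to dlog, a difference of A-linear maps, so by cyclicity of
-- the trace tr dlog changes by tr (∇₂′ − ∇′) − tr (∇₂ − ∇); for the diagonal connections n∇ on nP and
-- nQ this is n times an element of Ω. Moreover dlog is additive under composition, natural for
-- isomorphisms of triples and block diagonal on direct sums, so, again by cyclicity, tr dlog respects
-- the relations of K₁(A; ℤ/n) modulo nΩ. D is the signed sum of these traces, computed with
-- Grassmann connections.

open import Level using (Level; _⊔_)
open import Data.Nat using (ℕ; zero; suc; _≤_) renaming (_+_ to _+ℕ_)
open import Data.Fin using (Fin; splitAt)
import Data.Fin as Fin
open import Data.Sum using (_⊎_; inj₁; inj₂)
import Data.Sum as Sum
open import Data.Product using (Σ; _,_; proj₁; proj₂)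
open import Data.Bool using (true; false)
open import Data.List using (List; []; _∷_; _++_; map; concat; tabulate)
open import Data.List.Properties using (++-assoc; ++-identityʳ; map-++)
open import Data.Unit.Polymorphic using (tt)
open import Data.Vec.Functional using (Vector)
open import Function using (_∘_)
open import Relation.Binary.PropositionalEquality using (_≡_; refl)
open import Relation.Binary.Bundles using (Setoid)
open import Relation.Binary.Core using (Rel)
open import Relation.Binary.Structures using (IsEquivalence)
open import Algebra.Definitions using (Congruent₂; Commutative)
open import Algebra.Structures using (IsCommutativeMonoid)
import Relation.Binary.PropositionalEquality as ≡
open import Algebra.Bundles using (Monoid; Group; AbelianGroup; CommutativeMonoid; CommutativeRing)
open import Algebra.Morphism.Structures using (module MonoidMorphisms; module RingMorphisms)
import Algebra.Properties.Monoid.Sum as MonoidSum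
open import Algebra.Module.Bundles using (Module)
open import Algebra.Module.Morphism.Structures using (module ModuleMorphisms)
import Algebra.Module.Construct.TensorUnit as TensorUnit
import Algebra.Module.Morphism.Construct.Composition as Comp
open import Defs

module _ {a ℓa} (M : Monoid a ℓa) where
  open Monoid M
  open MonoidSum M using (sum)

  sum-splitAt : ∀ m {n} (v : Fin m ⊎ Fin n → Carrier) →
                sum {m +ℕ n} (v ∘ splitAt m) ≈ sum (v ∘ inj₁) ∙ sum (v ∘ inj₂)
  sum-splitAt zero    v = sym (identityˡ _)
  sum-splitAt (suc m) v = trans (∙-congˡ (sum-splitAt m (v ∘ Sum.map₁ Fin.suc))) (sym (assoc _ _ _))

module _ {a ℓa b ℓb} {M : Monoid a ℓa} {N : Monoid b ℓb} {f : Monoid.Carrier M → Monoid.Carrier N}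
         (f-homo : MonoidMorphisms.IsMonoidHomomorphism (Monoid.rawMonoid M) (Monoid.rawMonoid N) f) where
  open MonoidMorphisms.IsMonoidHomomorphism f-homo
  open Monoid N using (trans; ∙-congˡ; _≈_)
  private
    module ΣM = MonoidSum M
    module ΣN = MonoidSum N

  sum-homo : ∀ {l} (v : Vector (Monoid.Carrier M) l) → f (ΣM.sum v) ≈ ΣN.sum (f ∘ v)
  sum-homo {zero}  v = ε-homo
  sum-homo {suc l} v = trans (homo _ _) (∙-congˡ (sum-homo (v ∘ Fin.suc)))

++-isCommutativeMonoid : ∀ {a ℓ} {X : Set a} {_≈_ : Rel (List X) ℓ} → IsEquivalence _≈_ →
                         Congruent₂ _≈_ _++_ → Commutative _≈_ _++_ → IsCommutativeMonoid _≈_ _++_ []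
++-isCommutativeMonoid isEquivalence ++-cong ++-comm = record
  { isMonoid = record
    { isSemigroup = record
      { isMagma = record { isEquivalence = isEquivalence ; ∙-cong = ++-cong }
      ; assoc   = λ x y z → reflexive (++-assoc x y z) }
    ; identity = (λ x → ≈-refl) , (λ x → reflexive (++-identityʳ x)) }
  ; comm = ++-comm }
  where open IsEquivalence isEquivalence using (reflexive) renaming (refl to ≈-refl)

module AdditiveMap {g ℓg h ℓh} {G : Group g ℓg} {H : Group h ℓh} {f : Group.Carrier G → Group.Carrier H}
  (f-cong : ∀ {x y} → Group._≈_ G x y → Group._≈_ H (f x) (f y))
  (f-homo : ∀ x y → Group._≈_ H (f (Group._∙_ G x y)) (Group._∙_ H (f x) (f y))) where
  private
    module G = Group G
  open Group H
  open import Algebra.Properties.Group H using (inverseʳ-unique; identityˡ-unique)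
  open import Relation.Binary.Reasoning.Setoid setoid

  ε-homo : f G.ε ≈ ε
  ε-homo = identityˡ-unique (f G.ε) (f G.ε) (trans (sym (f-homo G.ε G.ε)) (f-cong (G.identityˡ G.ε)))

  ⁻¹-homo : ∀ x → f (x G.⁻¹) ≈ f x ⁻¹
  ⁻¹-homo x = inverseʳ-unique (f x) (f (x G.⁻¹)) (begin
    f x ∙ f (x G.⁻¹)  ≈⟨ f-homo x (x G.⁻¹) ⟨
    f (x G.∙ x G.⁻¹)  ≈⟨ f-cong (G.inverseʳ x) ⟩
    f G.ε             ≈⟨ ε-homo ⟩
    ε                 ∎)

module CongruenceModMultiples {g ℓg} (G : AbelianGroup g ℓg) where
  open AbelianGroup G hiding (refl)
  open import Algebra.Definitions.RawMonoid rawMonoid using (_×_)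
  open import Algebra.Properties.Monoid.Mult monoid using (×-congʳ)
  open import Algebra.Properties.CommutativeMonoid.Mult commutativeMonoid using (×-distrib-+)
  open import Algebra.Properties.CommutativeSemigroup commutativeSemigroup using (interchange)
  open import Relation.Binary.Reasoning.Setoid setoid
  module Multiple n = AdditiveMap {G = group} {H = group} {f = n ×_} (×-congʳ n) (λ x y → ×-distrib-+ x y n)

  infix 4 _≈[mod_·]_
  -- A record rather than a Σ-type, so that n can be inferred from the type.
  record _≈[mod_·]_ (x : Carrier) (n : ℕ) (y : Carrier) : Set (g ⊔ ℓg) where
    constructor difference
    field
      quotient : Carrier
      eq       : x ≈ y ∙ n × quotient

  module _ {n : ℕ} where
    open Multiple n renaming (ε-homo to ×-ε; ⁻¹-homo to ×-⁻¹)

    ≈⇒≈[mod·] : ∀ {x y} → x ≈ y → x ≈[mod n ·] y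
    ≈⇒≈[mod·] {x} {y} x≈y = difference ε (begin
      x          ≈⟨ x≈y ⟩
      y          ≈⟨ identityʳ y ⟨
      y ∙ ε      ≈⟨ ∙-congˡ ×-ε ⟨
      y ∙ n × ε  ∎)

    ≈∙[×-×]⇒≈[mod·] : ∀ {x y} a b → x ≈ y ∙ (n × a - n × b) → x ≈[mod n ·] y
    ≈∙[×-×]⇒≈[mod·] {x} {y} a b x≈ = difference (a - b) (begin
      x                      ≈⟨ x≈ ⟩
      y ∙ (n × a - n × b)    ≈⟨ ∙-congˡ (∙-congˡ (×-⁻¹ b)) ⟨
      y ∙ (n × a ∙ n × (b ⁻¹)) ≈⟨ ∙-congˡ (×-distrib-+ a (b ⁻¹) n) ⟨
      y ∙ n × (a - b)        ∎)

    ≈[mod·]-refl : ∀ {x} → x ≈[mod n ·] x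
    ≈[mod·]-refl = ≈⇒≈[mod·] (AbelianGroup.refl G)

    ≈[mod·]-sym : ∀ {x y} → x ≈[mod n ·] y → y ≈[mod n ·] x
    ≈[mod·]-sym {x} {y} (difference z x≈y+nz) = difference (z ⁻¹) (begin
      y                          ≈⟨ identityʳ y ⟨
      y ∙ ε                      ≈⟨ ∙-congˡ (inverseʳ (n × z)) ⟨
      y ∙ (n × z ∙ (n × z) ⁻¹)   ≈⟨ assoc y (n × z) _ ⟨
      y ∙ n × z ∙ (n × z) ⁻¹     ≈⟨ ∙-cong x≈y+nz (×-⁻¹ z) ⟨
      x ∙ n × (z ⁻¹)             ∎)

    ≈[mod·]-trans : ∀ {x y w} → x ≈[mod n ·] y → y ≈[mod n ·] w → x ≈[mod n ·] w
    ≈[mod·]-trans {x} {y} {w} (difference z x≈y+nz) (difference z' y≈w+nz') = difference (z' ∙ z) (begin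
      x                   ≈⟨ x≈y+nz ⟩
      y ∙ n × z           ≈⟨ ∙-congʳ y≈w+nz' ⟩
      w ∙ n × z' ∙ n × z  ≈⟨ assoc w _ _ ⟩
      w ∙ (n × z' ∙ n × z) ≈⟨ ∙-congˡ (×-distrib-+ z' z n) ⟨
      w ∙ n × (z' ∙ z)    ∎)

    ∙-cong-≈[mod·] : ∀ {x x' y y'} → x ≈[mod n ·] x' → y ≈[mod n ·] y' → x ∙ y ≈[mod n ·] x' ∙ y'
    ∙-cong-≈[mod·] {x} {x'} {y} {y'} (difference z x≈) (difference z' y≈) = difference (z ∙ z') (begin
      x ∙ y                            ≈⟨ ∙-cong x≈ y≈ ⟩
      (x' ∙ n × z) ∙ (y' ∙ n × z')     ≈⟨ interchange x' _ y' _ ⟩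
      (x' ∙ y') ∙ (n × z ∙ n × z')     ≈⟨ ∙-congˡ (×-distrib-+ z z' n) ⟨
      (x' ∙ y') ∙ n × (z ∙ z')         ∎)

module _ {g ℓg} (G : AbelianGroup g ℓg) where
  open AbelianGroup G
  open import Algebra.Properties.AbelianGroup G using (⁻¹-∙-comm; ⁻¹-anti-homo‿-)
  open import Algebra.Properties.CommutativeSemigroup commutativeSemigroup using (interchange)
  open import Relation.Binary.Reasoning.Setoid setoid

  [x-y]∙[y-z]≈x-z : ∀ x y z → (x - y) ∙ (y - z) ≈ x - z
  [x-y]∙[y-z]≈x-z x y z = begin
    (x ∙ y ⁻¹) ∙ (y ∙ z ⁻¹)  ≈⟨ assoc x (y ⁻¹) _ ⟩
    x ∙ (y ⁻¹ ∙ (y ∙ z ⁻¹))  ≈⟨ ∙-congˡ (assoc (y ⁻¹) y _) ⟨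
    x ∙ (y ⁻¹ ∙ y ∙ z ⁻¹)    ≈⟨ ∙-congˡ (∙-congʳ (inverseˡ y)) ⟩
    x ∙ (ε ∙ z ⁻¹)           ≈⟨ ∙-congˡ (identityˡ _) ⟩
    x ∙ z ⁻¹                 ∎

  [u-v]∙[[x-u]-[y-v]]≈x-y : ∀ u v x y → (u - v) ∙ ((x - u) - (y - v)) ≈ x - y
  [u-v]∙[[x-u]-[y-v]]≈x-y u v x y = begin
    (u - v) ∙ ((x - u) ∙ (y - v) ⁻¹)  ≈⟨ ∙-congˡ (∙-congˡ (⁻¹-anti-homo‿- y v)) ⟩
    (u - v) ∙ ((x - u) ∙ (v - y))     ≈⟨ ∙-congˡ (comm (x - u) (v - y)) ⟩
    (u - v) ∙ ((v - y) ∙ (x - u))     ≈⟨ assoc (u - v) (v - y) (x - u) ⟨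
    ((u - v) ∙ (v - y)) ∙ (x - u)     ≈⟨ ∙-congʳ ([x-y]∙[y-z]≈x-z u v y) ⟩
    (u - y) ∙ (x - u)                 ≈⟨ comm (u - y) (x - u) ⟩
    (x - u) ∙ (u - y)                 ≈⟨ [x-y]∙[y-z]≈x-z x u y ⟩
    x - y                             ∎

  [x∙y]-[u∙v]≈[x-u]∙[y-v] : ∀ x y u v → (x ∙ y) - (u ∙ v) ≈ (x - u) ∙ (y - v)
  [x∙y]-[u∙v]≈[x-u]∙[y-v] x y u v = begin
    (x ∙ y) ∙ (u ∙ v) ⁻¹     ≈⟨ ∙-congˡ (⁻¹-∙-comm u v) ⟨
    (x ∙ y) ∙ (u ⁻¹ ∙ v ⁻¹)  ≈⟨ interchange x y (u ⁻¹) (v ⁻¹) ⟩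
    (x ∙ u ⁻¹) ∙ (y ∙ v ⁻¹)  ∎

  x∙z-y∙z≈x-y : ∀ x y z → (x ∙ z) - (y ∙ z) ≈ x - y
  x∙z-y∙z≈x-y x y z = trans ([x∙y]-[u∙v]≈[x-u]∙[y-v] x z y z) (trans (∙-congˡ (inverseʳ z)) (identityʳ (x - y)))

module Dlog {ck ℓk c ℓ} (k : CommutativeRing ck ℓk) (A : CommutativeRing c ℓ)
            (ι : CommutativeRing.Carrier k → CommutativeRing.Carrier A) where

  open KD k A ι
  module R = CommutativeRing A
  open R using (_+_; _*_; -_; 0#; 1#; _≈_) renaming (Carrier to ∣A∣)

  private
    variable
      m ℓm m' ℓm' m'' ℓm'' m‴ ℓm‴ : Level

  ≡⇒≈Ω : ∀ {x y} → x ≡ y → x ≈Ω y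
  ≡⇒≈Ω refl = Ω-refl

  Ω-commutativeMonoid : CommutativeMonoid c (ck ⊔ c ⊔ ℓ)
  Ω-commutativeMonoid = record
    { Carrier = ΩC ; _≈_ = _≈Ω_ ; _∙_ = _++_ ; ε = []
    ; isCommutativeMonoid = ++-isCommutativeMonoid (record { refl = Ω-refl ; sym = Ω-sym ; trans = Ω-trans }) Ω-++ Ω-comm }

  open import Algebra.Properties.CommutativeSemigroup (CommutativeMonoid.commutativeSemigroup Ω-commutativeMonoid)
    public using () renaming (interchange to Ω-interchange)

  Ω-setoid : Setoid c (ck ⊔ c ⊔ ℓ)
  Ω-setoid = CommutativeMonoid.setoid Ω-commutativeMonoid

  Ω-monoid : Monoid c (ck ⊔ c ⊔ ℓ)
  Ω-monoid = CommutativeMonoid.monoid Ω-commutativeMonoid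

  ·Ω-++ : ∀ r x y → r ·Ω (x ++ y) ≡ r ·Ω x ++ r ·Ω y
  ·Ω-++ r x y = map-++ _ x y

  ·Ω-congˡ : ∀ r {x y} → x ≈Ω y → r ·Ω x ≈Ω r ·Ω y
  ·Ω-congˡ r Ω-refl          = Ω-refl
  ·Ω-congˡ r (Ω-sym e)       = Ω-sym (·Ω-congˡ r e)
  ·Ω-congˡ r (Ω-trans e e')  = Ω-trans (·Ω-congˡ r e) (·Ω-congˡ r e')
  ·Ω-congˡ r (Ω-++ {x} {x'} {y} {y'} e e') =
    Ω-trans (≡⇒≈Ω (·Ω-++ r x y)) (Ω-trans (Ω-++ (·Ω-congˡ r e) (·Ω-congˡ r e')) (Ω-sym (≡⇒≈Ω (·Ω-++ r x' y'))))
  ·Ω-congˡ r (Ω-comm x y)    =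
    Ω-trans (≡⇒≈Ω (·Ω-++ r x y)) (Ω-trans (Ω-comm (r ·Ω x) (r ·Ω y)) (Ω-sym (≡⇒≈Ω (·Ω-++ r y x))))
  ·Ω-congˡ r (Ω-cong e e')   = Ω-cong (R.*-congˡ e) e'
  ·Ω-congˡ r (Ω-addˡ a a' b) = Ω-trans (Ω-cong (R.distribˡ r a a') R.refl) (Ω-addˡ _ _ _)
  ·Ω-congˡ r (Ω-zeroˡ b)     = Ω-trans (Ω-cong (R.zeroʳ r) R.refl) (Ω-zeroˡ b)
  ·Ω-congˡ r (Ω-addʳ a b b') = Ω-addʳ (r * a) b b'
  ·Ω-congˡ r (Ω-leib a b b') =
    Ω-trans (Ω-leib (r * a) b b') (Ω-++ (Ω-cong (R.*-assoc r a b) R.refl) (Ω-cong (R.*-assoc r a b') R.refl))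
  ·Ω-congˡ r (Ω-const a λ')  = Ω-const (r * a) λ'

  ·Ω-congʳ : ∀ {r s} x → r ≈ s → r ·Ω x ≈Ω s ·Ω x
  ·Ω-congʳ []      r≈s = Ω-refl
  ·Ω-congʳ (_ ∷ x) r≈s = Ω-++ (Ω-cong (R.*-congʳ r≈s) R.refl) (·Ω-congʳ x r≈s)

  ·Ω-distribʳ : ∀ r s x → (r + s) ·Ω x ≈Ω r ·Ω x ++ s ·Ω x
  ·Ω-distribʳ r s [] = Ω-refl
  ·Ω-distribʳ r s ((a , b) ∷ x) =
    Ω-trans (Ω-++ (Ω-trans (Ω-cong (R.distribʳ a r s) R.refl) (Ω-addˡ _ _ _)) (·Ω-distribʳ r s x))
            (Ω-interchange ((r * a , b) ∷ []) ((s * a , b) ∷ []) _ _)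

  ·Ω-zeroˡ : ∀ x → 0# ·Ω x ≈Ω []
  ·Ω-zeroˡ []            = Ω-refl
  ·Ω-zeroˡ ((a , b) ∷ x) = Ω-++ (Ω-trans (Ω-cong (R.zeroˡ a) R.refl) (Ω-zeroˡ b)) (·Ω-zeroˡ x)

  ·Ω-assoc : ∀ r s x → r ·Ω (s ·Ω x) ≈Ω (r * s) ·Ω x
  ·Ω-assoc r s []      = Ω-refl
  ·Ω-assoc r s (_ ∷ x) = Ω-++ (Ω-cong (R.sym (R.*-assoc r s _)) R.refl) (·Ω-assoc r s x)

  ·Ω-identityˡ : ∀ x → 1# ·Ω x ≈Ω x
  ·Ω-identityˡ []      = Ω-refl
  ·Ω-identityˡ (_ ∷ x) = Ω-++ (Ω-cong (R.*-identityˡ _) R.refl) (·Ω-identityˡ x)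

  -Ω_ : ΩC → ΩC
  -Ω_ = (- 1#) ·Ω_

  -Ω‿inverseʳ : ∀ x → x ++ -Ω x ≈Ω []
  -Ω‿inverseʳ x = Ω-trans (Ω-++ (Ω-sym (·Ω-identityˡ x)) Ω-refl)
    (Ω-trans (Ω-sym (·Ω-distribʳ 1# (- 1#) x)) (Ω-trans (·Ω-congʳ x (R.-‿inverseʳ 1#)) (·Ω-zeroˡ x)))

  Ω-abelianGroup : AbelianGroup c (ck ⊔ c ⊔ ℓ)
  Ω-abelianGroup = record
    { Carrier = ΩC ; _≈_ = _≈Ω_ ; _∙_ = _++_ ; ε = [] ; _⁻¹ = -Ω_
    ; isAbelianGroup = record
      { isGroup = record
        { isMonoid = CommutativeMonoid.isMonoid Ω-commutativeMonoid
        ; inverse = (λ x → Ω-trans (Ω-comm (-Ω x) x) (-Ω‿inverseʳ x)) , -Ω‿inverseʳ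
        ; ⁻¹-cong = ·Ω-congˡ (- 1#) }
      ; comm = Ω-comm } }

  open CongruenceModMultiples Ω-abelianGroup public
  open import Algebra.Definitions.RawMonoid (AbelianGroup.rawMonoid Ω-abelianGroup) public using () renaming (_×_ to _×Ω_)

  nTimes≡× : ∀ n x → nTimes n x ≡ n ×Ω x
  nTimes≡× zero    x = refl
  nTimes≡× (suc n) x = ≡.cong (x ++_) (nTimes≡× n x)

  ≈[mod·]⇒≈[mod] : ∀ {n x y} → x ≈[mod n ·] y → x ≈[mod n ] y
  ≈[mod·]⇒≈[mod] {n} {y = y} (difference z x≈y+nz) = z , Ω-trans x≈y+nz (≡⇒≈Ω (≡.cong (y ++_) (≡.sym (nTimes≡× n z))))

  Aᴹ : Module A c ℓ
  Aᴹ = TensorUnit.⟨module⟩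

  ∑ᴹ : (M : Module A m ℓm) → ∀ {l} → (Fin l → Module.Carrierᴹ M) → Module.Carrierᴹ M
  ∑ᴹ M = MonoidSum.sum (Module.+ᴹ-monoid M)

  ∑ᴹ-cong : (M : Module A m ℓm) → ∀ {l} {v w : Fin l → Module.Carrierᴹ M} →
            (∀ j → Module._≈ᴹ_ M (v j) (w j)) → Module._≈ᴹ_ M (∑ᴹ M v) (∑ᴹ M w)
  ∑ᴹ-cong M = MonoidSum.sum-cong-≋ (Module.+ᴹ-monoid M)

  sumᴹ≡∑ᴹ : (M : Module A m ℓm) → ∀ {l} (v : Fin l → Module.Carrierᴹ M) → sumᴹ M v ≡ ∑ᴹ M v
  sumᴹ≡∑ᴹ M {zero}  v = refl
  sumᴹ≡∑ᴹ M {suc l} v = ≡.cong (Module._+ᴹ_ M (v Fin.zero)) (sumᴹ≡∑ᴹ M (λ j → v (Fin.suc j)))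

  record IsLinear (M : Module A m ℓm) (N : Module A m' ℓm') (f : Module.Carrierᴹ M → Module.Carrierᴹ N)
                  : Set (c ⊔ m ⊔ ℓm ⊔ ℓm') where
    private
      module M = Module M
      module N = Module N
    field
      ⟦⟧-cong : ∀ {x y} → x M.≈ᴹ y → f x N.≈ᴹ f y
      +ᴹ-homo : ∀ x y → f (x M.+ᴹ y) N.≈ᴹ f x N.+ᴹ f y
      *ᵣ-homo : ∀ x a → f (x M.*ᵣ a) N.≈ᴹ f x N.*ᵣ a

    open AdditiveMap {G = M.+ᴹ-group} {H = N.+ᴹ-group} ⟦⟧-cong +ᴹ-homo public
      renaming (ε-homo to 0ᴹ-homo; ⁻¹-homo to -ᴹ-homo)

    ∑-homo : ∀ {l} (v : Fin l → M.Carrierᴹ) → f (∑ᴹ M v) N.≈ᴹ ∑ᴹ N (λ j → f (v j))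
    ∑-homo = sum-homo {M = M.+ᴹ-monoid} {N = N.+ᴹ-monoid} (record
      { isMagmaHomomorphism = record { isRelHomomorphism = record { cong = ⟦⟧-cong } ; homo = +ᴹ-homo }
      ; ε-homo = 0ᴹ-homo })

  record LinearMap (M : Module A m ℓm) (N : Module A m' ℓm') : Set (c ⊔ m ⊔ ℓm ⊔ m' ⊔ ℓm') where
    field
      ⟦_⟧      : Module.Carrierᴹ M → Module.Carrierᴹ N
      isLinear : IsLinear M N ⟦_⟧
    open IsLinear isLinear public

  open LinearMap public using (⟦_⟧)

  isModuleHomomorphism⇒isLinear : {M : Module A m ℓm} {N : Module A m' ℓm'} {f : Module.Carrierᴹ M → Module.Carrierᴹ N} →
    ModuleMorphisms.IsModuleHomomorphism (Module.rawModule M) (Module.rawModule N) f → IsLinear M N f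
  isModuleHomomorphism⇒isLinear f-homo = record
    { ⟦⟧-cong = ⟦⟧-cong ; +ᴹ-homo = +ᴹ-homo ; *ᵣ-homo = λ x a → *ᵣ-homo a x }
    where open ModuleMorphisms.IsModuleHomomorphism f-homo

  idₗ : {M : Module A m ℓm} → LinearMap M M
  idₗ {M = M} = record { ⟦_⟧ = λ x → x ; isLinear = record
    { ⟦⟧-cong = λ e → e ; +ᴹ-homo = λ _ _ → ≈ᴹ-refl ; *ᵣ-homo = λ _ _ → ≈ᴹ-refl } }
    where open Module M

  infixr 9 _∘ₗ_
  _∘ₗ_ : {M : Module A m ℓm} {N : Module A m' ℓm'} {P : Module A m'' ℓm''} →
         LinearMap N P → LinearMap M N → LinearMap M P
  _∘ₗ_ {P = P} g f = record { ⟦_⟧ = λ x → ⟦ g ⟧ (⟦ f ⟧ x) ; isLinear = record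
    { ⟦⟧-cong = λ e → G.⟦⟧-cong (F.⟦⟧-cong e)
    ; +ᴹ-homo = λ x y → ≈ᴹ-trans (G.⟦⟧-cong (F.+ᴹ-homo x y)) (G.+ᴹ-homo _ _)
    ; *ᵣ-homo = λ x a → ≈ᴹ-trans (G.⟦⟧-cong (F.*ᵣ-homo x a)) (G.*ᵣ-homo _ _) } }
    where
      module F = LinearMap f
      module G = LinearMap g
      open Module P

  -ₗ : {M : Module A m ℓm} → LinearMap M M
  -ₗ {M = M} = record { ⟦_⟧ = -ᴹ_ ; isLinear = record
    { ⟦⟧-cong = -ᴹ‿cong
    ; +ᴹ-homo = λ x y → ≈ᴹ-sym (⁻¹-∙-comm x y)
    ; *ᵣ-homo = λ x a → ≈ᴹ-sym (·a.⁻¹-homo a x) } }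
    where
      open Module M
      open import Algebra.Properties.AbelianGroup +ᴹ-abelianGroup using (⁻¹-∙-comm)
      module ·a a = AdditiveMap {G = +ᴹ-group} {H = +ᴹ-group} {f = _*ᵣ a} (λ e → *ᵣ-cong e R.refl) (λ x y → *ᵣ-distribʳ a x y)

  module Tensor (M : Module A m ℓm) where
    open Module M

    infix 4 _≈ₜ_
    _≈ₜ_ : TensorC M → TensorC M → Set (ck ⊔ c ⊔ ℓ ⊔ m ⊔ ℓm)
    _≈ₜ_ = _≈⊗_ M

    ≡⇒≈⊗ : ∀ {t t'} → t ≡ t' → t ≈ₜ t'
    ≡⇒≈⊗ refl = ⊗-refl

    ⊗-commutativeMonoid : CommutativeMonoid (m ⊔ c) (ck ⊔ c ⊔ ℓ ⊔ m ⊔ ℓm)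
    ⊗-commutativeMonoid = record
      { Carrier = TensorC M ; _≈_ = _≈ₜ_ ; _∙_ = _++_ ; ε = []
      ; isCommutativeMonoid = ++-isCommutativeMonoid (record { refl = ⊗-refl ; sym = ⊗-sym ; trans = ⊗-trans }) ⊗-++ ⊗-comm }

    open import Algebra.Properties.CommutativeSemigroup (CommutativeMonoid.commutativeSemigroup ⊗-commutativeMonoid)
      public using () renaming (interchange to ⊗-interchange)

    ·⊗-++ : ∀ t t' a → _·⊗_ M (t ++ t') a ≡ _·⊗_ M t a ++ _·⊗_ M t' a
    ·⊗-++ t t' a = map-++ _ t t'

    ·⊗-cong : ∀ {t t'} a → t ≈ₜ t' → _·⊗_ M t a ≈ₜ _·⊗_ M t' a
    ·⊗-cong a ⊗-refl = ⊗-refl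
    ·⊗-cong a (⊗-sym e) = ⊗-sym (·⊗-cong a e)
    ·⊗-cong a (⊗-trans e e') = ⊗-trans (·⊗-cong a e) (·⊗-cong a e')
    ·⊗-cong a (⊗-++ {x} {x'} {y} {y'} e e') =
      ⊗-trans (≡⇒≈⊗ (·⊗-++ x y a)) (⊗-trans (⊗-++ (·⊗-cong a e) (·⊗-cong a e')) (⊗-sym (≡⇒≈⊗ (·⊗-++ x' y' a))))
    ·⊗-cong a (⊗-comm x y) =
      ⊗-trans (≡⇒≈⊗ (·⊗-++ x y a)) (⊗-trans (⊗-comm (_·⊗_ M x a) (_·⊗_ M y a)) (⊗-sym (≡⇒≈⊗ (·⊗-++ y x a))))
    ·⊗-cong a (⊗-cong e e') = ⊗-cong e (·Ω-congˡ a e')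
    ·⊗-cong a (⊗-addˡ p p' ω) = ⊗-addˡ p p' _
    ·⊗-cong a (⊗-zeroˡ ω) = ⊗-zeroˡ _
    ·⊗-cong a (⊗-addʳ p ω ω') = ⊗-trans (⊗-cong ≈ᴹ-refl (≡⇒≈Ω (·Ω-++ a ω ω'))) (⊗-addʳ p _ _)
    ·⊗-cong a (⊗-zeroʳ p) = ⊗-zeroʳ p
    ·⊗-cong a (⊗-bal r p ω) = ⊗-trans (⊗-bal r p (a ·Ω ω)) (⊗-cong ≈ᴹ-refl
      (Ω-trans (·Ω-assoc r a ω) (Ω-trans (·Ω-congʳ ω (R.*-comm r a)) (Ω-sym (·Ω-assoc a r ω)))))

    neg⊗-++ : ∀ t t' → neg⊗ M (t ++ t') ≡ neg⊗ M t ++ neg⊗ M t'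
    neg⊗-++ t t' = map-++ _ t t'

    neg⊗-·⊗ : ∀ t a → neg⊗ M (_·⊗_ M t a) ≡ _·⊗_ M (neg⊗ M t) a
    neg⊗-·⊗ []      a = refl
    neg⊗-·⊗ (_ ∷ t) a = ≡.cong (_ ∷_) (neg⊗-·⊗ t a)

    neg⊗-inverseʳ : ∀ t → t ++ neg⊗ M t ≈ₜ []
    neg⊗-inverseʳ [] = ⊗-refl
    neg⊗-inverseʳ ((p , ω) ∷ t) = ⊗-trans (⊗-interchange ((p , ω) ∷ []) t ((-ᴹ p , ω) ∷ []) (neg⊗ M t))
      (⊗-++ {x' = []} (⊗-trans (⊗-sym (⊗-addˡ p (-ᴹ p) ω)) (⊗-trans (⊗-cong (-ᴹ‿inverseʳ p) Ω-refl) (⊗-zeroˡ ω)))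
                      (neg⊗-inverseʳ t))

    -- contract φ is φ ⊗ id : M ⊗ Ω → A ⊗ Ω = Ω.
    contract : (Carrierᴹ → ∣A∣) → TensorC M → ΩC
    contract φ t = concat (map (λ q → φ (proj₁ q) ·Ω proj₂ q) t)

    contract-++ : ∀ φ t t' → contract φ (t ++ t') ≡ contract φ t ++ contract φ t'
    contract-++ φ []      t' = refl
    contract-++ φ (q ∷ t) t' =
      ≡.trans (≡.cong (_ ++_) (contract-++ φ t t')) (≡.sym (++-assoc (φ (proj₁ q) ·Ω proj₂ q) _ _))

    contract-pointwise : ∀ {φ ψ} → (∀ p → φ p ≈ ψ p) → ∀ t → contract φ t ≈Ω contract ψ t
    contract-pointwise e []            = Ω-refl
    contract-pointwise e ((p , ω) ∷ t) = Ω-++ (·Ω-congʳ ω (e p)) (contract-pointwise e t)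

    contract-+ : ∀ φ ψ t → contract (λ p → φ p + ψ p) t ≈Ω contract φ t ++ contract ψ t
    contract-+ φ ψ []            = Ω-refl
    contract-+ φ ψ ((p , ω) ∷ t) = Ω-trans (Ω-++ (·Ω-distribʳ (φ p) (ψ p) ω) (contract-+ φ ψ t))
                                           (Ω-interchange (φ p ·Ω ω) (ψ p ·Ω ω) (contract φ t) (contract ψ t))

    contract-0 : ∀ t → contract (λ _ → 0#) t ≈Ω []
    contract-0 []            = Ω-refl
    contract-0 ((p , ω) ∷ t) = Ω-++ {y' = []} (·Ω-zeroˡ ω) (contract-0 t)

    contract-·⊗ : ∀ φ t a → contract φ (_·⊗_ M t a) ≈Ω contract (λ p → φ p * a) t
    contract-·⊗ φ []            a = Ω-refl
    contract-·⊗ φ ((p , ω) ∷ t) a = Ω-++ (·Ω-assoc (φ p) a ω) (contract-·⊗ φ t a)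

    contract-cong : (φ : LinearMap M Aᴹ) → ∀ {t t'} → t ≈ₜ t' → contract ⟦ φ ⟧ t ≈Ω contract ⟦ φ ⟧ t'
    contract-cong φ ⊗-refl = Ω-refl
    contract-cong φ (⊗-sym e) = Ω-sym (contract-cong φ e)
    contract-cong φ (⊗-trans e e') = Ω-trans (contract-cong φ e) (contract-cong φ e')
    contract-cong φ (⊗-++ {x} {x'} {y} {y'} e e') =
      Ω-trans (≡⇒≈Ω (contract-++ ⟦ φ ⟧ x y))
        (Ω-trans (Ω-++ (contract-cong φ e) (contract-cong φ e')) (Ω-sym (≡⇒≈Ω (contract-++ ⟦ φ ⟧ x' y'))))
    contract-cong φ (⊗-comm x y) =
      Ω-trans (≡⇒≈Ω (contract-++ ⟦ φ ⟧ x y))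
        (Ω-trans (Ω-comm (contract ⟦ φ ⟧ x) _) (Ω-sym (≡⇒≈Ω (contract-++ ⟦ φ ⟧ y x))))
    contract-cong φ (⊗-cong e e') = Ω-++ (Ω-trans (·Ω-congʳ _ (LinearMap.⟦⟧-cong φ e)) (·Ω-congˡ _ e')) Ω-refl
    contract-cong φ (⊗-addˡ p p' ω) =
      Ω-trans (Ω-++ (Ω-trans (·Ω-congʳ ω (LinearMap.+ᴹ-homo φ p p')) (·Ω-distribʳ (⟦ φ ⟧ p) (⟦ φ ⟧ p') ω)) (Ω-refl {[]}))
              (≡⇒≈Ω (++-assoc (⟦ φ ⟧ p ·Ω ω) _ []))
    contract-cong φ (⊗-zeroˡ ω) = Ω-++ {y' = []} (Ω-trans (·Ω-congʳ ω (LinearMap.0ᴹ-homo φ)) (·Ω-zeroˡ ω)) Ω-refl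
    contract-cong φ (⊗-addʳ p ω ω') =
      Ω-trans (Ω-++ (≡⇒≈Ω (·Ω-++ (⟦ φ ⟧ p) ω ω')) (Ω-refl {[]})) (≡⇒≈Ω (++-assoc (⟦ φ ⟧ p ·Ω ω) _ []))
    contract-cong φ (⊗-zeroʳ p) = Ω-refl
    contract-cong φ (⊗-bal a p ω) =
      Ω-++ (Ω-trans (·Ω-congʳ ω (LinearMap.*ᵣ-homo φ p a)) (Ω-sym (·Ω-assoc (⟦ φ ⟧ p) a ω))) Ω-refl

  module _ {M : Module A m ℓm} {N : Module A m' ℓm'} where
    private
      module M = Module M
      module N = Module N
      module TN = Tensor N

    infix 10 _⊗id
    _⊗id : LinearMap M N → TensorC M → TensorC N
    (f ⊗id) t = map⊗ {M = M} {N = N} ⟦ f ⟧ t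

    ⊗id-++ : ∀ (f : LinearMap M N) t t' → (f ⊗id) (t ++ t') ≡ (f ⊗id) t ++ (f ⊗id) t'
    ⊗id-++ f t t' = map-++ _ t t'

    ⊗id-·⊗ : ∀ (f : LinearMap M N) t a → (f ⊗id) (_·⊗_ M t a) ≡ _·⊗_ N ((f ⊗id) t) a
    ⊗id-·⊗ f []      a = refl
    ⊗id-·⊗ f (q ∷ t) a = ≡.cong (_ ∷_) (⊗id-·⊗ f t a)

    ⊗id-pointwise : ∀ {f g : LinearMap M N} → (∀ p → ⟦ f ⟧ p N.≈ᴹ ⟦ g ⟧ p) → ∀ t → _≈⊗_ N ((f ⊗id) t) ((g ⊗id) t)
    ⊗id-pointwise e []            = ⊗-refl
    ⊗id-pointwise {f} {g} e ((p , ω) ∷ t) = ⊗-++ (⊗-cong {p = ⟦ f ⟧ p} {ω = ω} (e p) Ω-refl) (⊗id-pointwise {f} {g} e t)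

    ⊗id-cong : ∀ (f : LinearMap M N) {t t'} → _≈⊗_ M t t' → _≈⊗_ N ((f ⊗id) t) ((f ⊗id) t')
    ⊗id-cong f ⊗-refl = ⊗-refl
    ⊗id-cong f (⊗-sym e) = ⊗-sym (⊗id-cong f e)
    ⊗id-cong f (⊗-trans e e') = ⊗-trans (⊗id-cong f e) (⊗id-cong f e')
    ⊗id-cong f (⊗-++ {x} {x'} {y} {y'} e e') =
      ⊗-trans (TN.≡⇒≈⊗ (⊗id-++ f x y)) (⊗-trans (⊗-++ (⊗id-cong f e) (⊗id-cong f e')) (⊗-sym (TN.≡⇒≈⊗ (⊗id-++ f x' y'))))
    ⊗id-cong f (⊗-comm x y) =
      ⊗-trans (TN.≡⇒≈⊗ (⊗id-++ f x y)) (⊗-trans (⊗-comm ((f ⊗id) x) _) (⊗-sym (TN.≡⇒≈⊗ (⊗id-++ f y x))))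
    ⊗id-cong f (⊗-cong e e') = ⊗-cong (LinearMap.⟦⟧-cong f e) e'
    ⊗id-cong f (⊗-addˡ p p' ω) = ⊗-trans (⊗-cong (LinearMap.+ᴹ-homo f p p') Ω-refl) (⊗-addˡ _ _ ω)
    ⊗id-cong f (⊗-zeroˡ ω) = ⊗-trans (⊗-cong (LinearMap.0ᴹ-homo f) Ω-refl) (⊗-zeroˡ ω)
    ⊗id-cong f (⊗-addʳ p ω ω') = ⊗-addʳ _ ω ω'
    ⊗id-cong f (⊗-zeroʳ p) = ⊗-zeroʳ _
    ⊗id-cong f (⊗-bal a p ω) = ⊗-trans (⊗-cong (LinearMap.*ᵣ-homo f p a) Ω-refl) (⊗-bal a _ ω)

    contract-⊗id : ∀ (φ : N.Carrierᴹ → ∣A∣) (f : LinearMap M N) t →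
                   Tensor.contract N φ ((f ⊗id) t) ≡ Tensor.contract M (λ p → φ (⟦ f ⟧ p)) t
    contract-⊗id φ f []      = refl
    contract-⊗id φ f (q ∷ t) = ≡.cong (_ ++_) (contract-⊗id φ f t)

  ⊗id-∘ : {M : Module A m ℓm} {N : Module A m' ℓm'} {P : Module A m'' ℓm''} (g : LinearMap N P) (f : LinearMap M N) →
          ∀ t → (g ⊗id) ((f ⊗id) t) ≡ ((g ∘ₗ f) ⊗id) t
  ⊗id-∘ g f []      = refl
  ⊗id-∘ g f (q ∷ t) = ≡.cong (_ ∷_) (⊗id-∘ g f t)

  ⊗id-identity : {M : Module A m ℓm} → ∀ t → (idₗ {M = M} ⊗id) t ≡ t
  ⊗id-identity []      = refl
  ⊗id-identity {M = M} (q ∷ t) = ≡.cong (q ∷_) (⊗id-identity {M = M} t)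

  neg⊗-cong : {M : Module A m ℓm} {t t' : TensorC M} → _≈⊗_ M t t' → _≈⊗_ M (neg⊗ M t) (neg⊗ M t')
  neg⊗-cong = ⊗id-cong -ₗ

  ⊗-abelianGroup : (M : Module A m ℓm) → AbelianGroup (m ⊔ c) (ck ⊔ c ⊔ ℓ ⊔ m ⊔ ℓm)
  ⊗-abelianGroup M = record
    { _⁻¹ = neg⊗ M
    ; isAbelianGroup = record
      { isGroup = record
        { isMonoid = CommutativeMonoid.isMonoid ⊗-commutativeMonoid
        ; inverse = (λ t → ⊗-trans (⊗-comm (neg⊗ M t) t) (neg⊗-inverseʳ t)) , neg⊗-inverseʳ
        ; ⁻¹-cong = neg⊗-cong }
      ; comm = ⊗-comm } }
    where open Tensor M

  module _ {M : Module A m ℓm} where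
    open Tensor M

    contract-neg : (φ : LinearMap M Aᴹ) → ∀ t → contract ⟦ φ ⟧ (neg⊗ M t) ≈Ω -Ω contract ⟦ φ ⟧ t
    contract-neg φ = ⁻¹-homo
      where open AdditiveMap {G = AbelianGroup.group (⊗-abelianGroup M)} {H = AbelianGroup.group Ω-abelianGroup}
                             (contract-cong φ) (λ t t' → ≡⇒≈Ω (contract-++ ⟦ φ ⟧ t t'))

  module _ {M : Module A m ℓm} {N : Module A m' ℓm'} where
    ⊗id-neg : (f : LinearMap M N) → ∀ t → _≈⊗_ N ((f ⊗id) (neg⊗ M t)) (neg⊗ N ((f ⊗id) t))
    ⊗id-neg f = ⁻¹-homo
      where open AdditiveMap {G = AbelianGroup.group (⊗-abelianGroup M)} {H = AbelianGroup.group (⊗-abelianGroup N)}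
                             (⊗id-cong f) (λ t t' → Tensor.≡⇒≈⊗ N (⊗id-++ f t t'))

    ⊗id-difference : (f : LinearMap M N) → ∀ t t' →
                     _≈⊗_ N ((f ⊗id) (t ++ neg⊗ M t')) ((f ⊗id) t ++ neg⊗ N ((f ⊗id) t'))
    ⊗id-difference f t t' = ⊗-trans (Tensor.≡⇒≈⊗ N (⊗id-++ f t (neg⊗ M t'))) (⊗-++ ⊗-refl (⊗id-neg f t'))

  ∑⊗ : (M : Module A m ℓm) → ∀ {l} → (Fin l → TensorC M) → TensorC M
  ∑⊗ M = MonoidSum.sum (CommutativeMonoid.monoid (Tensor.⊗-commutativeMonoid M))

  record IsLinear⊗ (M : Module A m ℓm) (N : Module A m' ℓm') (h : Module.Carrierᴹ M → TensorC N)
                   : Set (ck ⊔ c ⊔ ℓ ⊔ m ⊔ ℓm ⊔ m' ⊔ ℓm') where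
    private
      module M = Module M
    field
      cong    : ∀ {x y} → x M.≈ᴹ y → _≈⊗_ N (h x) (h y)
      +ᴹ-homo : ∀ x y → _≈⊗_ N (h (x M.+ᴹ y)) (h x ++ h y)
      *ᵣ-homo : ∀ x a → _≈⊗_ N (h (x M.*ᵣ a)) (_·⊗_ N (h x) a)

    open AdditiveMap {G = M.+ᴹ-group} {H = AbelianGroup.group (⊗-abelianGroup N)} cong +ᴹ-homo public
      renaming (ε-homo to 0ᴹ-homo; ⁻¹-homo to -ᴹ-homo)

    ∑-homo : ∀ {l} (v : Fin l → M.Carrierᴹ) → _≈⊗_ N (h (∑ᴹ M v)) (∑⊗ N (λ j → h (v j)))
    ∑-homo = sum-homo {M = M.+ᴹ-monoid} {N = CommutativeMonoid.monoid (Tensor.⊗-commutativeMonoid N)} (record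
      { isMagmaHomomorphism = record { isRelHomomorphism = record { cong = cong } ; homo = +ᴹ-homo }
      ; ε-homo = 0ᴹ-homo })

  ⊗id-linear⊗ : {M : Module A m ℓm} {N : Module A m' ℓm'} {P : Module A m'' ℓm''} {h : Module.Carrierᴹ M → TensorC N} →
                IsLinear⊗ M N h → (f : LinearMap N P) → IsLinear⊗ M P (λ x → (f ⊗id) (h x))
  ⊗id-linear⊗ {P = P} {h} h-linear f = record
    { cong    = λ e → ⊗id-cong f (H.cong e)
    ; +ᴹ-homo = λ x y → ⊗-trans (⊗id-cong f (H.+ᴹ-homo x y)) (≡⇒≈⊗ (⊗id-++ f (h x) (h y)))
    ; *ᵣ-homo = λ x a → ⊗-trans (⊗id-cong f (H.*ᵣ-homo x a)) (≡⇒≈⊗ (⊗id-·⊗ f (h x) a)) }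
    where
      module H = IsLinear⊗ h-linear
      open Tensor P using (≡⇒≈⊗)

  record IsConnectionAlong {M : Module A m ℓm} {N : Module A m' ℓm'} (g : LinearMap M N)
                           (h : Module.Carrierᴹ M → TensorC N) : Set (ck ⊔ c ⊔ ℓ ⊔ m ⊔ ℓm ⊔ m' ⊔ ℓm') where
    private
      module M = Module M
    field
      cong    : ∀ {x y} → x M.≈ᴹ y → _≈⊗_ N (h x) (h y)
      +ᴹ-homo : ∀ x y → _≈⊗_ N (h (x M.+ᴹ y)) (h x ++ h y)
      leibniz : ∀ x a → _≈⊗_ N (h (x M.*ᵣ a)) (_·⊗_ N (h x) a ++ ((⟦ g ⟧ x , d a) ∷ []))

  module _ {M : Module A m ℓm} {N : Module A m' ℓm'} (f : LinearMap M N) where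
    private
      module F = LinearMap f
      module TN = Tensor N

    connection-∘ : (C : Connection N) → IsConnectionAlong f (λ x → Connection.∇ C (⟦ f ⟧ x))
    connection-∘ C = record
      { cong    = λ e → ∇-cong (F.⟦⟧-cong e)
      ; +ᴹ-homo = λ x y → ⊗-trans (∇-cong (F.+ᴹ-homo x y)) (∇-add _ _)
      ; leibniz = λ x a → ⊗-trans (∇-cong (F.*ᵣ-homo x a)) (∇-leib _ _) }
      where open Connection C

    ⊗id-connection : (C : Connection M) → IsConnectionAlong f (λ x → (f ⊗id) (Connection.∇ C x))
    ⊗id-connection C = record
      { cong    = λ e → ⊗id-cong f (∇-cong e)
      ; +ᴹ-homo = λ x y → ⊗-trans (⊗id-cong f (∇-add x y)) (TN.≡⇒≈⊗ (⊗id-++ f (∇ x) (∇ y)))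
      ; leibniz = λ x a → ⊗-trans (⊗id-cong f (∇-leib x a))
          (TN.≡⇒≈⊗ (≡.trans (⊗id-++ f (_·⊗_ M (∇ x) a) _) (≡.cong (_++ _) (⊗id-·⊗ f (∇ x) a)))) }
      where open Connection C

    connection-difference-linear : ∀ {h h'} → IsConnectionAlong f h → IsConnectionAlong f h' →
                                   IsLinear⊗ M N (λ x → h x ++ neg⊗ N (h' x))
    connection-difference-linear {h} {h'} h-conn h'-conn = record
      { cong    = λ e → ⊗-++ (H.cong e) (neg⊗-cong (H'.cong e))
      ; +ᴹ-homo = λ x y → ⊗-trans (⊗-++ (H.+ᴹ-homo x y) (⊗-trans (neg⊗-cong (H'.+ᴹ-homo x y)) (TN.≡⇒≈⊗ (TN.neg⊗-++ (h' x) (h' y)))))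
                                   (TN.⊗-interchange (h x) (h y) (neg⊗ N (h' x)) (neg⊗ N (h' y)))
      ; *ᵣ-homo = λ x a → begin
          h (x M.*ᵣ a) ++ neg⊗ N (h' (x M.*ᵣ a))
            ≈⟨ ⊗-++ (H.leibniz x a) (neg⊗-cong (H'.leibniz x a)) ⟩
          (_·⊗_ N (h x) a ++ q x a) ++ neg⊗ N (_·⊗_ N (h' x) a ++ q x a)
            ≈⟨ x∙z-y∙z≈x-y (⊗-abelianGroup N) (_·⊗_ N (h x) a) (_·⊗_ N (h' x) a) (q x a) ⟩
          _·⊗_ N (h x) a ++ neg⊗ N (_·⊗_ N (h' x) a)
            ≡⟨ ≡.cong₂ _++_ refl (TN.neg⊗-·⊗ (h' x) a) ⟩
          _·⊗_ N (h x) a ++ _·⊗_ N (neg⊗ N (h' x)) a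
            ≡⟨ TN.·⊗-++ (h x) (neg⊗ N (h' x)) a ⟨
          _·⊗_ N (h x ++ neg⊗ N (h' x)) a ∎ }
      where
        module M = Module M
        module H = IsConnectionAlong h-conn
        module H' = IsConnectionAlong h'-conn
        q : M.Carrierᴹ → ∣A∣ → TensorC N
        q x a = (⟦ f ⟧ x , d a) ∷ []
        open AbelianGroup (⊗-abelianGroup N) using (setoid)
        open import Relation.Binary.Reasoning.Setoid setoid

  connection-along-id : {M : Module A m ℓm} (C : Connection M) → IsConnectionAlong idₗ (Connection.∇ C)
  connection-along-id C = record { cong = ∇-cong ; +ᴹ-homo = ∇-add ; leibniz = ∇-leib }
    where open Connection C

  open MonoidSum Ω-monoid public using () renaming (sum to ∑Ω)
  open import Algebra.Properties.CommutativeMonoid.Sum Ω-commutativeMonoid public using (∑-distrib-+; ∑-comm)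
    renaming (sum-cong-≋ to ∑Ω-cong; sum-cong-≗ to ∑Ω-cong-≗)

  concat-tabulate : ∀ {l} (v : Fin l → ΩC) → concat (tabulate v) ≡ ∑Ω v
  concat-tabulate {zero}  v = refl
  concat-tabulate {suc l} v = ≡.cong (v Fin.zero ++_) (concat-tabulate (λ j → v (Fin.suc j)))

  record Coordinates (M : Module A m ℓm) : Set (c ⊔ ℓ ⊔ m ⊔ ℓm) where
    field
      rawCoord : RawCoord M
    open RawCoord rawCoord public
    open Module M
    field
      φs-linear : ∀ j → IsLinear M Aᴹ (φs j)
      dual      : ∀ x → x ≈ᴹ ∑ᴹ M (λ j → xs j *ᵣ φs j x)

    φ : Fin len → LinearMap M Aᴹ
    φ j = record { ⟦_⟧ = φs j ; isLinear = φs-linear j }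

  fromIsFGP : {M : Module A m ℓm} → IsFGP M → Coordinates M
  fromIsFGP {M = M} M-fgp = record
    { rawCoord  = coord
    ; φs-linear = λ j → isModuleHomomorphism⇒isLinear (φ-linear j)
    ; dual      = λ x → Module.≈ᴹ-trans M (dual x) (Module.≈ᴹ-reflexive M (sumᴹ≡∑ᴹ M (λ j → Module._*ᵣ_ M (xs j) (φs j x)))) }
    where open IsFGP M-fgp

  module _ {M : Module A m ℓm} where
    open Tensor M

    contract-sum : ∀ {l} (φ : Fin l → Module.Carrierᴹ M → ∣A∣) t →
                   contract (λ p → ∑ᴹ Aᴹ (λ j → φ j p)) t ≈Ω ∑Ω (λ j → contract (φ j) t)
    contract-sum {zero}  φ t = contract-0 t
    contract-sum {suc l} φ t = Ω-trans (contract-+ (φ Fin.zero) _ t) (Ω-++ Ω-refl (contract-sum (λ j → φ (Fin.suc j)) t))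

    contract-∑⊗ : (φ : LinearMap M Aᴹ) → ∀ {l} (v : Fin l → TensorC M) →
                  contract ⟦ φ ⟧ (∑⊗ M v) ≈Ω ∑Ω (λ j → contract ⟦ φ ⟧ (v j))
    contract-∑⊗ φ = sum-homo {M = CommutativeMonoid.monoid ⊗-commutativeMonoid} {N = Ω-monoid} (record
      { isMagmaHomomorphism = record
        { isRelHomomorphism = record { cong = contract-cong φ }
        ; homo = λ t t' → ≡⇒≈Ω (contract-++ ⟦ φ ⟧ t t') }
      ; ε-homo = Ω-refl })

  -Ω-∑ : ∀ {l} (v : Fin l → ΩC) → -Ω ∑Ω v ≈Ω ∑Ω (λ j → -Ω v j)
  -Ω-∑ = sum-homo {M = Ω-monoid} {N = Ω-monoid} (record
    { isMagmaHomomorphism = record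
      { isRelHomomorphism = record { cong = ·Ω-congˡ (- 1#) }
      ; homo = λ x y → ≡⇒≈Ω (·Ω-++ (- 1#) x y) }
    ; ε-homo = Ω-refl })

  module Trace {M : Module A m ℓm} (cs : Coordinates M) where
    open Coordinates cs
    open Tensor M
    open import Relation.Binary.Reasoning.Setoid Ω-setoid

    tr≡∑ : ∀ h → tr M rawCoord h ≡ ∑Ω (λ j → contract (φs j) (h (xs j)))
    tr≡∑ h = concat-tabulate (λ j → contract (φs j) (h (xs j)))

    tr-cong : ∀ {h h'} → (∀ x → h x ≈ₜ h' x) → tr M rawCoord h ≈Ω tr M rawCoord h'
    tr-cong {h} {h'} h≈h' = begin
      tr M rawCoord h                            ≡⟨ tr≡∑ h ⟩
      ∑Ω (λ j → contract (φs j) (h (xs j)))      ≈⟨ ∑Ω-cong (λ j → contract-cong (φ j) (h≈h' (xs j))) ⟩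
      ∑Ω (λ j → contract (φs j) (h' (xs j)))     ≡⟨ tr≡∑ h' ⟨
      tr M rawCoord h'                           ∎

    tr-++ : ∀ h h' → tr M rawCoord (λ x → h x ++ h' x) ≈Ω tr M rawCoord h ++ tr M rawCoord h'
    tr-++ h h' = begin
      tr M rawCoord (λ x → h x ++ h' x)
        ≡⟨ tr≡∑ (λ x → h x ++ h' x) ⟩
      ∑Ω (λ j → contract (φs j) (h (xs j) ++ h' (xs j)))
        ≡⟨ ∑Ω-cong-≗ (λ j → contract-++ (φs j) (h (xs j)) (h' (xs j))) ⟩
      ∑Ω (λ j → contract (φs j) (h (xs j)) ++ contract (φs j) (h' (xs j)))
        ≈⟨ ∑-distrib-+ (λ j → contract (φs j) (h (xs j))) (λ j → contract (φs j) (h' (xs j))) ⟩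
      ∑Ω (λ j → contract (φs j) (h (xs j))) ++ ∑Ω (λ j → contract (φs j) (h' (xs j)))
        ≡⟨ ≡.cong₂ _++_ (tr≡∑ h) (tr≡∑ h') ⟨
      tr M rawCoord h ++ tr M rawCoord h' ∎

    tr-neg : ∀ h → tr M rawCoord (λ x → neg⊗ M (h x)) ≈Ω -Ω tr M rawCoord h
    tr-neg h = begin
      tr M rawCoord (λ x → neg⊗ M (h x))           ≡⟨ tr≡∑ (λ x → neg⊗ M (h x)) ⟩
      ∑Ω (λ j → contract (φs j) (neg⊗ M (h (xs j)))) ≈⟨ ∑Ω-cong (λ j → contract-neg (φ j) (h (xs j))) ⟩
      ∑Ω (λ j → -Ω contract (φs j) (h (xs j)))     ≈⟨ -Ω-∑ (λ j → contract (φs j) (h (xs j))) ⟨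
      -Ω ∑Ω (λ j → contract (φs j) (h (xs j)))     ≡⟨ ≡.cong -Ω_ (tr≡∑ h) ⟨
      -Ω tr M rawCoord h                           ∎

  module _ {M : Module A m ℓm} {N : Module A m' ℓm'} (csM : Coordinates M) (csN : Coordinates N) where
    private
      module CM = Coordinates csM
      module CN = Coordinates csN
      module M = Module M
      module N = Module N
      module TM = Tensor M
      module TN = Tensor N
    open import Relation.Binary.Reasoning.MultiSetoid

    -- Expanding f xⱼ in the coordinates (yᵢ, ψᵢ) of N gives a double sum with entries ψᵢ (f xⱼ);
    -- summed over j, the coordinate expansion in M recombines φⱼ p · ψᵢ (f xⱼ) into ψᵢ (f p).
    tr-cyclic : (f : LinearMap M N) {h : N.Carrierᴹ → TensorC M} → IsLinear⊗ N M h →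
                tr M CM.rawCoord (λ x → h (⟦ f ⟧ x)) ≈Ω tr N CN.rawCoord (λ y → (f ⊗id) (h y))
    tr-cyclic f {h} h-linear = begin⟨ Ω-setoid ⟩
      tr M CM.rawCoord (λ x → h (⟦ f ⟧ x))
        ≈⟨ ≡⇒≈Ω (Trace.tr≡∑ csM (λ x → h (⟦ f ⟧ x))) ⟩
      ∑Ω (λ j → TM.contract (CM.φs j) (h (⟦ f ⟧ (CM.xs j))))
        ≈⟨ ∑Ω-cong expand ⟩
      ∑Ω (λ j → ∑Ω (λ i → TM.contract (λ p → CM.φs j p * entry i j) (h (CN.xs i))))
        ≈⟨ ∑-comm (λ j i → TM.contract (λ p → CM.φs j p * entry i j) (h (CN.xs i))) ⟩
      ∑Ω (λ i → ∑Ω (λ j → TM.contract (λ p → CM.φs j p * entry i j) (h (CN.xs i))))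
        ≈⟨ ∑Ω-cong collapse ⟩
      ∑Ω (λ i → TN.contract (CN.φs i) ((f ⊗id) (h (CN.xs i))))
        ≈⟨ ≡⇒≈Ω (Trace.tr≡∑ csN (λ y → (f ⊗id) (h y))) ⟨
      tr N CN.rawCoord (λ y → (f ⊗id) (h y)) ∎
      where
        module H = IsLinear⊗ h-linear
        entry : Fin CN.len → Fin CM.len → ∣A∣
        entry i j = CN.φs i (⟦ f ⟧ (CM.xs j))

        expand : ∀ j → TM.contract (CM.φs j) (h (⟦ f ⟧ (CM.xs j)))
                       ≈Ω ∑Ω (λ i → TM.contract (λ p → CM.φs j p * entry i j) (h (CN.xs i)))
        expand j = begin⟨ Ω-setoid ⟩
          TM.contract (CM.φs j) (h (⟦ f ⟧ (CM.xs j)))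
            ≈⟨ TM.contract-cong (CM.φ j) (H.cong (CN.dual (⟦ f ⟧ (CM.xs j)))) ⟩
          TM.contract (CM.φs j) (h (∑ᴹ N (λ i → CN.xs i N.*ᵣ entry i j)))
            ≈⟨ TM.contract-cong (CM.φ j) (H.∑-homo (λ i → CN.xs i N.*ᵣ entry i j)) ⟩
          TM.contract (CM.φs j) (∑⊗ M (λ i → h (CN.xs i N.*ᵣ entry i j)))
            ≈⟨ contract-∑⊗ (CM.φ j) (λ i → h (CN.xs i N.*ᵣ entry i j)) ⟩
          ∑Ω (λ i → TM.contract (CM.φs j) (h (CN.xs i N.*ᵣ entry i j)))
            ≈⟨ ∑Ω-cong (λ i → Ω-trans (TM.contract-cong (CM.φ j) (H.*ᵣ-homo (CN.xs i) (entry i j)))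
                                      (TM.contract-·⊗ (CM.φs j) (h (CN.xs i)) (entry i j))) ⟩
          ∑Ω (λ i → TM.contract (λ p → CM.φs j p * entry i j) (h (CN.xs i))) ∎

        coordinate-expansion : ∀ i p → ∑ᴹ Aᴹ (λ j → CM.φs j p * entry i j) ≈ CN.φs i (⟦ f ⟧ p)
        coordinate-expansion i p = R.sym (begin⟨ R.setoid ⟩
          ⟦ ψf ⟧ p                                      ≈⟨ ψf.⟦⟧-cong (CM.dual p) ⟩
          ⟦ ψf ⟧ (∑ᴹ M (λ j → CM.xs j M.*ᵣ CM.φs j p))  ≈⟨ ψf.∑-homo (λ j → CM.xs j M.*ᵣ CM.φs j p) ⟩
          ∑ᴹ Aᴹ (λ j → ⟦ ψf ⟧ (CM.xs j M.*ᵣ CM.φs j p)) ≈⟨ ∑ᴹ-cong Aᴹ (λ j → R.trans (ψf.*ᵣ-homo (CM.xs j) (CM.φs j p)) (R.*-comm _ _)) ⟩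
          ∑ᴹ Aᴹ (λ j → CM.φs j p * entry i j)           ∎)
          where
            ψf : LinearMap M Aᴹ
            ψf = CN.φ i ∘ₗ f
            module ψf = LinearMap ψf

        collapse : ∀ i → ∑Ω (λ j → TM.contract (λ p → CM.φs j p * entry i j) (h (CN.xs i)))
                         ≈Ω TN.contract (CN.φs i) ((f ⊗id) (h (CN.xs i)))
        collapse i = begin⟨ Ω-setoid ⟩
          ∑Ω (λ j → TM.contract (λ p → CM.φs j p * entry i j) (h (CN.xs i)))
            ≈⟨ contract-sum {M = M} (λ j p → CM.φs j p * entry i j) (h (CN.xs i)) ⟨
          TM.contract (λ p → ∑ᴹ Aᴹ (λ j → CM.φs j p * entry i j)) (h (CN.xs i))
            ≈⟨ TM.contract-pointwise (coordinate-expansion i) (h (CN.xs i)) ⟩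
          TM.contract (λ p → CN.φs i (⟦ f ⟧ p)) (h (CN.xs i))
            ≈⟨ ≡⇒≈Ω (contract-⊗id (CN.φs i) f (h (CN.xs i))) ⟨
          TN.contract (CN.φs i) ((f ⊗id) (h (CN.xs i))) ∎

  module DirectSum (M N : Module A m ℓm) where
    private
      module M = Module M
      module N = Module N
      module MN = Module (M ⊕ N)
      module TM = Tensor M
      module TN = Tensor N
      module TMN = Tensor (M ⊕ N)

    ι₁ : LinearMap M (M ⊕ N)
    ι₁ = record { ⟦_⟧ = λ u → u , N.0ᴹ ; isLinear = record
      { ⟦⟧-cong = λ e → e , N.≈ᴹ-refl
      ; +ᴹ-homo = λ _ _ → M.≈ᴹ-refl , N.≈ᴹ-sym (N.+ᴹ-identityˡ N.0ᴹ)
      ; *ᵣ-homo = λ _ a → M.≈ᴹ-refl , N.≈ᴹ-sym (N.*ᵣ-zeroˡ a) } }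

    ι₂ : LinearMap N (M ⊕ N)
    ι₂ = record { ⟦_⟧ = λ u' → M.0ᴹ , u' ; isLinear = record
      { ⟦⟧-cong = λ e → M.≈ᴹ-refl , e
      ; +ᴹ-homo = λ _ _ → M.≈ᴹ-sym (M.+ᴹ-identityˡ M.0ᴹ) , N.≈ᴹ-refl
      ; *ᵣ-homo = λ _ a → M.≈ᴹ-sym (M.*ᵣ-zeroˡ a) , N.≈ᴹ-refl } }

    π₁ : LinearMap (M ⊕ N) M
    π₁ = record { ⟦_⟧ = proj₁ ; isLinear = record
      { ⟦⟧-cong = proj₁ ; +ᴹ-homo = λ _ _ → M.≈ᴹ-refl ; *ᵣ-homo = λ _ _ → M.≈ᴹ-refl } }

    π₂ : LinearMap (M ⊕ N) N
    π₂ = record { ⟦_⟧ = proj₂ ; isLinear = record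
      { ⟦⟧-cong = proj₂ ; +ᴹ-homo = λ _ _ → N.≈ᴹ-refl ; *ᵣ-homo = λ _ _ → N.≈ᴹ-refl } }

    ι₁+ι₂≈id : ∀ u u' → ⟦ ι₁ ⟧ u MN.+ᴹ ⟦ ι₂ ⟧ u' MN.≈ᴹ (u , u')
    ι₁+ι₂≈id u u' = M.+ᴹ-identityʳ u , N.+ᴹ-identityˡ u'

    -- Verbatim the successor case of powCoord, so that power coordinates are direct-sum coordinates.
    ⊕-rawCoord : RawCoord M → RawCoord N → RawCoord (M ⊕ N)
    ⊕-rawCoord rc rc' = record
      { len = len +ℕ R'.len
      ; xs  = λ i → Sum.[ (λ j → (xs j , N.0ᴹ)) , (λ j → (M.0ᴹ , R'.xs j)) ] (splitAt len i)
      ; φs  = λ i → Sum.[ (λ j v → φs j (proj₁ v)) , (λ j v → R'.φs j (proj₂ v)) ] (splitAt len i)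
      }
      where open RawCoord rc
            module R' = RawCoord rc'

    module _ (csM : Coordinates M) (csN : Coordinates N) where
      private
        module CM = Coordinates csM
        module CN = Coordinates csN
        xS : Fin CM.len ⊎ Fin CN.len → MN.Carrierᴹ
        xS = Sum.[ (λ j → ⟦ ι₁ ⟧ (CM.xs j)) , (λ j → ⟦ ι₂ ⟧ (CN.xs j)) ]
        φS : Fin CM.len ⊎ Fin CN.len → MN.Carrierᴹ → ∣A∣
        φS = Sum.[ (λ j v → CM.φs j (proj₁ v)) , (λ j v → CN.φs j (proj₂ v)) ]

      ⊕-coordinates : Coordinates (M ⊕ N)
      ⊕-coordinates = record
        { rawCoord  = ⊕-rawCoord CM.rawCoord CN.rawCoord
        ; φs-linear = λ i → φS-linear (splitAt CM.len i)
        ; dual      = dual }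
        where
          φS-linear : ∀ s → IsLinear (M ⊕ N) Aᴹ (φS s)
          φS-linear (inj₁ j) = LinearMap.isLinear (CM.φ j ∘ₗ π₁)
          φS-linear (inj₂ j) = LinearMap.isLinear (CN.φ j ∘ₗ π₂)
          open import Relation.Binary.Reasoning.Setoid MN.≈ᴹ-setoid
          dual : ∀ x → x MN.≈ᴹ ∑ᴹ (M ⊕ N) (λ i → xS (splitAt CM.len i) MN.*ᵣ φS (splitAt CM.len i) x)
          dual (u , u') = begin
            (u , u')
              ≈⟨ ι₁+ι₂≈id u u' ⟨
            ⟦ ι₁ ⟧ u MN.+ᴹ ⟦ ι₂ ⟧ u'
              ≈⟨ MN.+ᴹ-cong (ι₁.⟦⟧-cong (CM.dual u)) (ι₂.⟦⟧-cong (CN.dual u')) ⟩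
            ⟦ ι₁ ⟧ (∑ᴹ M (λ j → CM.xs j M.*ᵣ CM.φs j u)) MN.+ᴹ ⟦ ι₂ ⟧ (∑ᴹ N (λ j → CN.xs j N.*ᵣ CN.φs j u'))
              ≈⟨ MN.+ᴹ-cong (ι₁.∑-homo (λ j → CM.xs j M.*ᵣ CM.φs j u)) (ι₂.∑-homo (λ j → CN.xs j N.*ᵣ CN.φs j u')) ⟩
            ∑ᴹ (M ⊕ N) (λ j → ⟦ ι₁ ⟧ (CM.xs j M.*ᵣ CM.φs j u)) MN.+ᴹ ∑ᴹ (M ⊕ N) (λ j → ⟦ ι₂ ⟧ (CN.xs j N.*ᵣ CN.φs j u'))
              ≈⟨ MN.+ᴹ-cong (∑ᴹ-cong (M ⊕ N) (λ j → ι₁.*ᵣ-homo (CM.xs j) (CM.φs j u)))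
                            (∑ᴹ-cong (M ⊕ N) (λ j → ι₂.*ᵣ-homo (CN.xs j) (CN.φs j u'))) ⟩
            ∑ᴹ (M ⊕ N) (λ j → xS (inj₁ j) MN.*ᵣ φS (inj₁ j) (u , u')) MN.+ᴹ ∑ᴹ (M ⊕ N) (λ j → xS (inj₂ j) MN.*ᵣ φS (inj₂ j) (u , u'))
              ≈⟨ sum-splitAt MN.+ᴹ-monoid CM.len (λ s → xS s MN.*ᵣ φS s (u , u')) ⟨
            ∑ᴹ (M ⊕ N) (λ i → xS (splitAt CM.len i) MN.*ᵣ φS (splitAt CM.len i) (u , u')) ∎
            where
              module ι₁ = LinearMap ι₁
              module ι₂ = LinearMap ι₂

      tr-⊕ : ∀ {h h₁ h₂} → (∀ u u' → _≈⊗_ (M ⊕ N) (h (u , u')) ((ι₁ ⊗id) (h₁ u) ++ (ι₂ ⊗id) (h₂ u'))) →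
             tr (M ⊕ N) (⊕-rawCoord CM.rawCoord CN.rawCoord) h ≈Ω tr M CM.rawCoord h₁ ++ tr N CN.rawCoord h₂
      tr-⊕ {h} {h₁} {h₂} h≈ = begin
        tr (M ⊕ N) (⊕-rawCoord CM.rawCoord CN.rawCoord) h
          ≈⟨ ≡⇒≈Ω (Trace.tr≡∑ ⊕-coordinates h) ⟩
        ∑Ω (λ i → G (splitAt CM.len i))
          ≈⟨ sum-splitAt Ω-monoid CM.len G ⟩
        ∑Ω (λ j → G (inj₁ j)) ++ ∑Ω (λ j → G (inj₂ j))
          ≈⟨ Ω-++ (∑Ω-cong first) (∑Ω-cong second) ⟩
        ∑Ω (λ j → TM.contract (CM.φs j) (h₁ (CM.xs j))) ++ ∑Ω (λ j → TN.contract (CN.φs j) (h₂ (CN.xs j)))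
          ≈⟨ ≡⇒≈Ω (≡.cong₂ _++_ (Trace.tr≡∑ csM h₁) (Trace.tr≡∑ csN h₂)) ⟨
        tr M CM.rawCoord h₁ ++ tr N CN.rawCoord h₂ ∎
        where
          open import Relation.Binary.Reasoning.Setoid Ω-setoid
          G : Fin CM.len ⊎ Fin CN.len → ΩC
          G s = TMN.contract (φS s) (h (xS s))
          first : ∀ j → G (inj₁ j) ≈Ω TM.contract (CM.φs j) (h₁ (CM.xs j))
          first j = begin
            TMN.contract ⟦ φπ₁ ⟧ (h (CM.xs j , N.0ᴹ))
              ≈⟨ TMN.contract-cong φπ₁ (h≈ (CM.xs j) N.0ᴹ) ⟩
            TMN.contract ⟦ φπ₁ ⟧ ((ι₁ ⊗id) (h₁ (CM.xs j)) ++ (ι₂ ⊗id) (h₂ N.0ᴹ))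
              ≈⟨ ≡⇒≈Ω (≡.trans (TMN.contract-++ ⟦ φπ₁ ⟧ ((ι₁ ⊗id) (h₁ (CM.xs j))) ((ι₂ ⊗id) (h₂ N.0ᴹ)))
                       (≡.cong₂ _++_ (contract-⊗id ⟦ φπ₁ ⟧ ι₁ (h₁ (CM.xs j))) (contract-⊗id ⟦ φπ₁ ⟧ ι₂ (h₂ N.0ᴹ)))) ⟩
            TM.contract (CM.φs j) (h₁ (CM.xs j)) ++ TN.contract (λ _ → CM.φs j M.0ᴹ) (h₂ N.0ᴹ)
              ≈⟨ Ω-++ Ω-refl (Ω-trans (TN.contract-pointwise (λ _ → LinearMap.0ᴹ-homo (CM.φ j)) (h₂ N.0ᴹ))
                                      (TN.contract-0 (h₂ N.0ᴹ))) ⟩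
            TM.contract (CM.φs j) (h₁ (CM.xs j)) ++ []
              ≈⟨ ≡⇒≈Ω (++-identityʳ _) ⟩
            TM.contract (CM.φs j) (h₁ (CM.xs j)) ∎
            where
              φπ₁ : LinearMap (M ⊕ N) Aᴹ
              φπ₁ = CM.φ j ∘ₗ π₁
          second : ∀ j → G (inj₂ j) ≈Ω TN.contract (CN.φs j) (h₂ (CN.xs j))
          second j = begin
            TMN.contract ⟦ φπ₂ ⟧ (h (M.0ᴹ , CN.xs j))
              ≈⟨ TMN.contract-cong φπ₂ (h≈ M.0ᴹ (CN.xs j)) ⟩
            TMN.contract ⟦ φπ₂ ⟧ ((ι₁ ⊗id) (h₁ M.0ᴹ) ++ (ι₂ ⊗id) (h₂ (CN.xs j)))
              ≈⟨ ≡⇒≈Ω (≡.trans (TMN.contract-++ ⟦ φπ₂ ⟧ ((ι₁ ⊗id) (h₁ M.0ᴹ)) ((ι₂ ⊗id) (h₂ (CN.xs j))))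
                       (≡.cong₂ _++_ (contract-⊗id ⟦ φπ₂ ⟧ ι₁ (h₁ M.0ᴹ)) (contract-⊗id ⟦ φπ₂ ⟧ ι₂ (h₂ (CN.xs j))))) ⟩
            TM.contract (λ _ → CN.φs j N.0ᴹ) (h₁ M.0ᴹ) ++ TN.contract (CN.φs j) (h₂ (CN.xs j))
              ≈⟨ Ω-++ (Ω-trans (TM.contract-pointwise (λ _ → LinearMap.0ᴹ-homo (CN.φ j)) (h₁ M.0ᴹ))
                               (TM.contract-0 (h₁ M.0ᴹ))) Ω-refl ⟩
            TN.contract (CN.φs j) (h₂ (CN.xs j)) ∎
            where
              φπ₂ : LinearMap (M ⊕ N) Aᴹ
              φπ₂ = CN.φ j ∘ₗ π₂

    infixr 6 _⊕ᶜ_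
    _⊕ᶜ_ : Connection M → Connection N → Connection (M ⊕ N)
    ∇₁ ⊕ᶜ ∇₂ = record
      { ∇      = ∇
      ; ∇-cong = λ (e , e') → ⊗-++ (⊗id-cong ι₁ (C₁.∇-cong e)) (⊗id-cong ι₂ (C₂.∇-cong e'))
      ; ∇-add  = λ x y → ⊗-trans (⊗-++ (E₁-add (C₁.∇ (proj₁ x)) (C₁.∇ (proj₁ y)) (C₁.∇-add (proj₁ x) (proj₁ y)))
                                       (E₂-add (C₂.∇ (proj₂ x)) (C₂.∇ (proj₂ y)) (C₂.∇-add (proj₂ x) (proj₂ y))))
                                 (TMN.⊗-interchange (E₁ (C₁.∇ (proj₁ x))) (E₁ (C₁.∇ (proj₁ y))) (E₂ (C₂.∇ (proj₂ x))) (E₂ (C₂.∇ (proj₂ y))))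
      ; ∇-leib = leibniz }
      where
        module C₁ = Connection ∇₁
        module C₂ = Connection ∇₂
        E₁ : TensorC M → TensorC (M ⊕ N)
        E₁ = ι₁ ⊗id
        E₂ : TensorC N → TensorC (M ⊕ N)
        E₂ = ι₂ ⊗id
        ∇ : MN.Carrierᴹ → TensorC (M ⊕ N)
        ∇ (u , u') = E₁ (C₁.∇ u) ++ E₂ (C₂.∇ u')
        E₁-add : ∀ {t} t₁ t₂ → _≈⊗_ M t (t₁ ++ t₂) → _≈⊗_ (M ⊕ N) (E₁ t) (E₁ t₁ ++ E₁ t₂)
        E₁-add t₁ t₂ e = ⊗-trans (⊗id-cong ι₁ e) (TMN.≡⇒≈⊗ (⊗id-++ ι₁ t₁ t₂))
        E₂-add : ∀ {t} t₁ t₂ → _≈⊗_ N t (t₁ ++ t₂) → _≈⊗_ (M ⊕ N) (E₂ t) (E₂ t₁ ++ E₂ t₂)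
        E₂-add t₁ t₂ e = ⊗-trans (⊗id-cong ι₂ e) (TMN.≡⇒≈⊗ (⊗id-++ ι₂ t₁ t₂))
        open import Relation.Binary.Reasoning.Setoid (CommutativeMonoid.setoid TMN.⊗-commutativeMonoid)
        leibniz : ∀ x a → _≈⊗_ (M ⊕ N) (∇ (x MN.*ᵣ a)) (_·⊗_ (M ⊕ N) (∇ x) a ++ ((x , d a) ∷ []))
        leibniz (u , u') a = begin
          E₁ (C₁.∇ (u M.*ᵣ a)) ++ E₂ (C₂.∇ (u' N.*ᵣ a))
            ≈⟨ ⊗-++ (E₁-add (_·⊗_ M (C₁.∇ u) a) _ (C₁.∇-leib u a)) (E₂-add (_·⊗_ N (C₂.∇ u') a) _ (C₂.∇-leib u' a)) ⟩
          (E₁ (_·⊗_ M (C₁.∇ u) a) ++ E₁ ((u , d a) ∷ [])) ++ (E₂ (_·⊗_ N (C₂.∇ u') a) ++ E₂ ((u' , d a) ∷ []))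
            ≈⟨ TMN.⊗-interchange (E₁ (_·⊗_ M (C₁.∇ u) a)) _ (E₂ (_·⊗_ N (C₂.∇ u') a)) _ ⟩
          (E₁ (_·⊗_ M (C₁.∇ u) a) ++ E₂ (_·⊗_ N (C₂.∇ u') a)) ++ ((⟦ ι₁ ⟧ u , d a) ∷ (⟦ ι₂ ⟧ u' , d a) ∷ [])
            ≈⟨ ⊗-++ (TMN.≡⇒≈⊗ (≡.cong₂ _++_ (⊗id-·⊗ ι₁ (C₁.∇ u) a) (⊗id-·⊗ ι₂ (C₂.∇ u') a)))
                    (⊗-sym (⊗-addˡ (⟦ ι₁ ⟧ u) (⟦ ι₂ ⟧ u') (d a))) ⟩
          (_·⊗_ (M ⊕ N) (E₁ (C₁.∇ u)) a ++ _·⊗_ (M ⊕ N) (E₂ (C₂.∇ u')) a) ++ ((⟦ ι₁ ⟧ u MN.+ᴹ ⟦ ι₂ ⟧ u' , d a) ∷ [])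
            ≈⟨ ⊗-++ (TMN.≡⇒≈⊗ (≡.sym (TMN.·⊗-++ (E₁ (C₁.∇ u)) (E₂ (C₂.∇ u')) a))) (⊗-cong (ι₁+ι₂≈id u u') Ω-refl) ⟩
          _·⊗_ (M ⊕ N) (E₁ (C₁.∇ u) ++ E₂ (C₂.∇ u')) a ++ (((u , u') , d a) ∷ []) ∎

  module Power (M : Module A m ℓm) where
    open DirectSum
    private
      module Mⁿ n = Module (power n M)

    -- The data are literally powCoord and pow∇, so that D-formula unfolds to a trace of dlog;
    -- only the proofs recurse through the direct-sum case.
    mutual
      power-coordinates : ∀ n → Coordinates M → Coordinates (power n M)
      power-coordinates n cs = record
        { rawCoord = powCoord n (Coordinates.rawCoord cs) ; φs-linear = power-φs-linear n cs ; dual = power-dual n cs }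

      power-φs-linear : ∀ n cs j → IsLinear (power n M) Aᴹ (RawCoord.φs (powCoord n (Coordinates.rawCoord cs)) j)
      power-φs-linear zero    cs ()
      power-φs-linear (suc n) cs = Coordinates.φs-linear (⊕-coordinates M (power n M) cs (power-coordinates n cs))

      power-dual : ∀ n cs x → let open RawCoord (powCoord n (Coordinates.rawCoord cs)) in
                   Mⁿ._≈ᴹ_ n x (∑ᴹ (power n M) (λ j → Mⁿ._*ᵣ_ n (xs j) (φs j x)))
      power-dual zero    cs x = _
      power-dual (suc n) cs   = Coordinates.dual (⊕-coordinates M (power n M) cs (power-coordinates n cs))

    mutual
      power-connection : ∀ n → Connection M → Connection (power n M)
      power-connection n C = record
        { ∇ = pow∇ n (Connection.∇ C) ; ∇-cong = power-∇-cong n C ; ∇-add = power-∇-add n C ; ∇-leib = power-∇-leib n C }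

      power-∇-cong : ∀ n C {x y} → Mⁿ._≈ᴹ_ n x y → _≈⊗_ (power n M) (pow∇ n (Connection.∇ C) x) (pow∇ n (Connection.∇ C) y)
      power-∇-cong zero    C _ = ⊗-refl
      power-∇-cong (suc n) C   = Connection.∇-cong (_⊕ᶜ_ M (power n M) C (power-connection n C))

      power-∇-add : ∀ n C x y → _≈⊗_ (power n M) (pow∇ n (Connection.∇ C) (Mⁿ._+ᴹ_ n x y))
                                                   (pow∇ n (Connection.∇ C) x ++ pow∇ n (Connection.∇ C) y)
      power-∇-add zero    C _ _ = ⊗-refl
      power-∇-add (suc n) C     = Connection.∇-add (_⊕ᶜ_ M (power n M) C (power-connection n C))

      power-∇-leib : ∀ n C x a → _≈⊗_ (power n M) (pow∇ n (Connection.∇ C) (Mⁿ._*ᵣ_ n x a))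
                                   (_·⊗_ (power n M) (pow∇ n (Connection.∇ C) x) a ++ ((x , d a) ∷ []))
      power-∇-leib zero    C _ a = ⊗-sym (⊗-zeroˡ (d a))
      power-∇-leib (suc n) C     = Connection.∇-leib (_⊕ᶜ_ M (power n M) C (power-connection n C))

    tr-power : ∀ n cs θ → tr (power n M) (powCoord n (Coordinates.rawCoord cs)) (pow∇ n θ) ≈Ω n ×Ω tr M (Coordinates.rawCoord cs) θ
    tr-power zero    cs θ = Ω-refl
    tr-power (suc n) cs θ =
      Ω-trans (tr-⊕ M (power n M) cs (power-coordinates n cs) {h₁ = θ} {h₂ = pow∇ n θ} (λ _ _ → ⊗-refl))
              (Ω-++ Ω-refl (tr-power n cs θ))

    module Embeddings (n : ℕ) where
      Mⁿ⁺¹ : Module A m ℓm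
      Mⁿ⁺¹ = power (suc n) M
      E₁ : TensorC M → TensorC Mⁿ⁺¹
      E₁ = ι₁ M (power n M) ⊗id
      E₂ : TensorC (power n M) → TensorC Mⁿ⁺¹
      E₂ = ι₂ M (power n M) ⊗id
      open Tensor Mⁿ⁺¹ public using (≡⇒≈⊗; ⊗-interchange; neg⊗-++; ⊗-commutativeMonoid)
      open import Relation.Binary.Reasoning.Setoid (CommutativeMonoid.setoid ⊗-commutativeMonoid) public

    pow∇-++ : ∀ n (h₁ h₂ : Module.Carrierᴹ M → TensorC M) y →
              _≈⊗_ (power n M) (pow∇ n (λ x → h₁ x ++ h₂ x) y) (pow∇ n h₁ y ++ pow∇ n h₂ y)
    pow∇-++ zero    h₁ h₂ y       = ⊗-refl
    pow∇-++ (suc n) h₁ h₂ (u , v) = begin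
      E₁ (h₁ u ++ h₂ u) ++ E₂ (pow∇ n (λ x → h₁ x ++ h₂ x) v)
        ≈⟨ ⊗-++ (≡⇒≈⊗ (⊗id-++ (ι₁ M (power n M)) (h₁ u) (h₂ u)))
                (⊗-trans (⊗id-cong (ι₂ M (power n M)) (pow∇-++ n h₁ h₂ v))
                         (≡⇒≈⊗ (⊗id-++ (ι₂ M (power n M)) (pow∇ n h₁ v) (pow∇ n h₂ v)))) ⟩
      (E₁ (h₁ u) ++ E₁ (h₂ u)) ++ (E₂ (pow∇ n h₁ v) ++ E₂ (pow∇ n h₂ v))
        ≈⟨ ⊗-interchange (E₁ (h₁ u)) (E₁ (h₂ u)) (E₂ (pow∇ n h₁ v)) (E₂ (pow∇ n h₂ v)) ⟩
      (E₁ (h₁ u) ++ E₂ (pow∇ n h₁ v)) ++ (E₁ (h₂ u) ++ E₂ (pow∇ n h₂ v)) ∎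
      where open Embeddings n

    pow∇-neg : ∀ n (h : Module.Carrierᴹ M → TensorC M) y →
               _≈⊗_ (power n M) (pow∇ n (λ x → neg⊗ M (h x)) y) (neg⊗ (power n M) (pow∇ n h y))
    pow∇-neg zero    h y       = ⊗-refl
    pow∇-neg (suc n) h (u , v) = begin
      E₁ (neg⊗ M (h u)) ++ E₂ (pow∇ n (λ x → neg⊗ M (h x)) v)
        ≈⟨ ⊗-++ (⊗id-neg (ι₁ M (power n M)) (h u))
                (⊗-trans (⊗id-cong (ι₂ M (power n M)) (pow∇-neg n h v)) (⊗id-neg (ι₂ M (power n M)) (pow∇ n h v))) ⟩
      neg⊗ Mⁿ⁺¹ (E₁ (h u)) ++ neg⊗ Mⁿ⁺¹ (E₂ (pow∇ n h v))
        ≡⟨ neg⊗-++ (E₁ (h u)) (E₂ (pow∇ n h v)) ⟨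
      neg⊗ Mⁿ⁺¹ (E₁ (h u) ++ E₂ (pow∇ n h v)) ∎
      where open Embeddings n

    pow∇-difference : ∀ n (h h' : Module.Carrierᴹ M → TensorC M) y →
                      _≈⊗_ (power n M) (pow∇ n (λ x → h x ++ neg⊗ M (h' x)) y)
                                       (pow∇ n h y ++ neg⊗ (power n M) (pow∇ n h' y))
    pow∇-difference n h h' y = ⊗-trans (pow∇-++ n h (λ x → neg⊗ M (h' x)) y) (⊗-++ ⊗-refl (pow∇-neg n h' y))

    tr-power-difference : ∀ n cs (C₁ C₂ : Connection M) →
      tr (power n M) (powCoord n (Coordinates.rawCoord cs))
         (λ y → pow∇ n (Connection.∇ C₂) y ++ neg⊗ (power n M) (pow∇ n (Connection.∇ C₁) y))
      ≈Ω n ×Ω tr M (Coordinates.rawCoord cs) (λ x → Connection.∇ C₂ x ++ neg⊗ M (Connection.∇ C₁ x))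
    tr-power-difference n cs C₁ C₂ =
      Ω-trans (Trace.tr-cong (power-coordinates n cs) (λ y → ⊗-sym (pow∇-difference n (Connection.∇ C₂) (Connection.∇ C₁) y)))
              (tr-power n cs (λ x → Connection.∇ C₂ x ++ neg⊗ M (Connection.∇ C₁ x)))

  record LinearIso (M : Module A m ℓm) (N : Module A m' ℓm') : Set (c ⊔ m ⊔ ℓm ⊔ m' ⊔ ℓm') where
    field
      to      : LinearMap M N
      from    : LinearMap N M
      to∘from : ∀ y → Module._≈ᴹ_ N (⟦ to ⟧ (⟦ from ⟧ y)) y
      from∘to : ∀ x → Module._≈ᴹ_ M (⟦ from ⟧ (⟦ to ⟧ x)) x

    ⊗id-from∘to : ∀ t → _≈⊗_ M ((from ⊗id) ((to ⊗id) t)) t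
    ⊗id-from∘to t = ⊗-trans (Tensor.≡⇒≈⊗ M (⊗id-∘ from to t))
                            (⊗-trans (⊗id-pointwise {f = from ∘ₗ to} {g = idₗ} from∘to t) (Tensor.≡⇒≈⊗ M (⊗id-identity {M = M} t)))

    ⊗id-to∘from : ∀ t → _≈⊗_ N ((to ⊗id) ((from ⊗id) t)) t
    ⊗id-to∘from t = ⊗-trans (Tensor.≡⇒≈⊗ N (⊗id-∘ to from t))
                            (⊗-trans (⊗id-pointwise {f = to ∘ₗ from} {g = idₗ} to∘from t) (Tensor.≡⇒≈⊗ N (⊗id-identity {M = N} t)))

  -- The inverse is the one chosen by surjectivity, as in Triple.α⁻¹, so that D-formula is literally
  -- a trace of dlog.
  fromIsModuleIsomorphism : {M : Module A m ℓm} {N : Module A m' ℓm'} {f : Module.Carrierᴹ M → Module.Carrierᴹ N} →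
    ModuleMorphisms.IsModuleIsomorphism (Module.rawModule M) (Module.rawModule N) f → LinearIso M N
  fromIsModuleIsomorphism {M = M} {N} {f} f-iso = record
    { to      = to
    ; from    = record { ⟦_⟧ = g ; isLinear = record
        { ⟦⟧-cong = λ {y} {y'} e → injective (N.≈ᴹ-trans (f∘g y) (N.≈ᴹ-trans e (N.≈ᴹ-sym (f∘g y'))))
        ; +ᴹ-homo = λ y y' → injective (N.≈ᴹ-trans (f∘g _)
            (N.≈ᴹ-sym (N.≈ᴹ-trans (F.+ᴹ-homo (g y) (g y')) (N.+ᴹ-cong (f∘g y) (f∘g y')))))
        ; *ᵣ-homo = λ y a → injective (N.≈ᴹ-trans (f∘g _)
            (N.≈ᴹ-sym (N.≈ᴹ-trans (F.*ᵣ-homo (g y) a) (N.*ᵣ-cong (f∘g y) R.refl)))) } }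
    ; to∘from = f∘g
    ; from∘to = λ x → injective (f∘g (f x)) }
    where
      module N = Module N
      open ModuleMorphisms.IsModuleIsomorphism f-iso using (isModuleHomomorphism; injective; surjective)
      to : LinearMap M N
      to = record { ⟦_⟧ = f ; isLinear = isModuleHomomorphism⇒isLinear isModuleHomomorphism }
      module F = LinearMap to
      g : N.Carrierᴹ → Module.Carrierᴹ M
      g y = proj₁ (surjective y)
      f∘g : ∀ y → f (g y) N.≈ᴹ y
      f∘g y = proj₂ (surjective y) (Module.≈ᴹ-refl M)

  idᵢ : {M : Module A m ℓm} → LinearIso M M
  idᵢ {M = M} = record { to = idₗ ; from = idₗ ; to∘from = λ _ → Module.≈ᴹ-refl M ; from∘to = λ _ → Module.≈ᴹ-refl M }

  module _ {M : Module A m ℓm} {N : Module A m' ℓm'} (α : LinearIso M N) where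
    private
      module α = LinearIso α
      module TM = Tensor M

    pullback : Connection N → Connection M
    pullback C = record
      { ∇      = λ x → (α.from ⊗id) (∇ (⟦ α.to ⟧ x))
      ; ∇-cong = λ e → ⊗id-cong α.from (∇-cong (LinearMap.⟦⟧-cong α.to e))
      ; ∇-add  = λ x y → ⊗-trans (⊗id-cong α.from (⊗-trans (∇-cong (LinearMap.+ᴹ-homo α.to x y)) (∇-add _ _)))
                                 (TM.≡⇒≈⊗ (⊗id-++ α.from (∇ (⟦ α.to ⟧ x)) (∇ (⟦ α.to ⟧ y))))
      ; ∇-leib = λ x a → ⊗-trans (⊗id-cong α.from (⊗-trans (∇-cong (LinearMap.*ᵣ-homo α.to x a)) (∇-leib _ _)))
          (⊗-trans (TM.≡⇒≈⊗ (⊗id-++ α.from (_·⊗_ N (∇ (⟦ α.to ⟧ x)) a) _))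
                   (⊗-++ (TM.≡⇒≈⊗ (⊗id-·⊗ α.from (∇ (⟦ α.to ⟧ x)) a)) (⊗-cong (α.from∘to x) Ω-refl))) }
      where open Connection C

  powMap-linear : {M N : Module A m ℓm} → ∀ n (f : LinearMap M N) → IsLinear (power n M) (power n N) (powMap n ⟦ f ⟧)
  powMap-linear zero    f = record { ⟦⟧-cong = λ _ → tt ; +ᴹ-homo = λ _ _ → tt ; *ᵣ-homo = λ _ _ → tt }
  powMap-linear (suc n) f = record
    { ⟦⟧-cong = λ (e , e') → F.⟦⟧-cong e , Fⁿ.⟦⟧-cong e'
    ; +ᴹ-homo = λ (x , xs) (y , ys) → F.+ᴹ-homo x y , Fⁿ.+ᴹ-homo xs ys
    ; *ᵣ-homo = λ (x , xs) a → F.*ᵣ-homo x a , Fⁿ.*ᵣ-homo xs a }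
    where
      module F = LinearMap f
      module Fⁿ = IsLinear (powMap-linear n f)

  powₗ : {M N : Module A m ℓm} → ∀ n → LinearMap M N → LinearMap (power n M) (power n N)
  powₗ n f = record { ⟦_⟧ = powMap n ⟦ f ⟧ ; isLinear = powMap-linear n f }

  powᵢ : {M N : Module A m ℓm} → ∀ n → LinearIso M N → LinearIso (power n M) (power n N)
  powᵢ {M = M} {N} n α = record
    { to = powₗ n α.to ; from = powₗ n α.from ; to∘from = to∘from n ; from∘to = from∘to n }
    where
      module α = LinearIso α
      to∘from : ∀ n y → Module._≈ᴹ_ (power n N) (powMap n ⟦ α.to ⟧ (powMap n ⟦ α.from ⟧ y)) y
      to∘from zero    y        = tt
      to∘from (suc n) (y , ys) = α.to∘from y , to∘from n ys
      from∘to : ∀ n x → Module._≈ᴹ_ (power n M) (powMap n ⟦ α.from ⟧ (powMap n ⟦ α.to ⟧ x)) x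
      from∘to zero    x        = tt
      from∘to (suc n) (x , xs) = α.from∘to x , from∘to n xs

  pow∇-natural : {M N : Module A m ℓm} → ∀ n (f : LinearMap M N) (g : LinearMap N M) (h : Module.Carrierᴹ N → TensorC N) x →
                 _≈⊗_ (power n M) (pow∇ n (λ y → (g ⊗id) (h (⟦ f ⟧ y))) x) ((powₗ n g ⊗id) (pow∇ n h (powMap n ⟦ f ⟧ x)))
  pow∇-natural         zero    f g h x       = ⊗-refl
  pow∇-natural {M = M} {N} (suc n) f g h (u , v) = begin
    (ι₁ᴹ ⊗id) ((g ⊗id) (h (⟦ f ⟧ u))) ++ (ι₂ᴹ ⊗id) (pow∇ n (λ y → (g ⊗id) (h (⟦ f ⟧ y))) v)
      ≈⟨ ⊗-++ (≡⇒≈⊗ (⊗id-∘ ι₁ᴹ g (h (⟦ f ⟧ u))))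
              (⊗-trans (⊗id-cong ι₂ᴹ (pow∇-natural n f g h v)) (≡⇒≈⊗ (⊗id-∘ ι₂ᴹ (powₗ n g) (pow∇ n h fⁿv)))) ⟩
    ((ι₁ᴹ ∘ₗ g) ⊗id) (h (⟦ f ⟧ u)) ++ ((ι₂ᴹ ∘ₗ powₗ n g) ⊗id) (pow∇ n h fⁿv)
      ≈⟨ ⊗-++ (⊗id-pointwise {f = ι₁ᴹ ∘ₗ g} {g = gⁿ⁺¹ ∘ₗ ι₁ᴺ} (λ _ → M.≈ᴹ-refl , Mⁿ.≈ᴹ-sym (LinearMap.0ᴹ-homo (powₗ n g))) (h (⟦ f ⟧ u)))
              (⊗id-pointwise {f = ι₂ᴹ ∘ₗ powₗ n g} {g = gⁿ⁺¹ ∘ₗ ι₂ᴺ} (λ _ → M.≈ᴹ-sym (LinearMap.0ᴹ-homo g) , Mⁿ.≈ᴹ-refl) (pow∇ n h fⁿv)) ⟩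
    ((gⁿ⁺¹ ∘ₗ ι₁ᴺ) ⊗id) (h (⟦ f ⟧ u)) ++ ((gⁿ⁺¹ ∘ₗ ι₂ᴺ) ⊗id) (pow∇ n h fⁿv)
      ≡⟨ ≡.cong₂ _++_ (⊗id-∘ gⁿ⁺¹ ι₁ᴺ (h (⟦ f ⟧ u))) (⊗id-∘ gⁿ⁺¹ ι₂ᴺ (pow∇ n h fⁿv)) ⟨
    (gⁿ⁺¹ ⊗id) ((ι₁ᴺ ⊗id) (h (⟦ f ⟧ u))) ++ (gⁿ⁺¹ ⊗id) ((ι₂ᴺ ⊗id) (pow∇ n h fⁿv))
      ≡⟨ ⊗id-++ gⁿ⁺¹ ((ι₁ᴺ ⊗id) (h (⟦ f ⟧ u))) ((ι₂ᴺ ⊗id) (pow∇ n h fⁿv)) ⟨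
    (gⁿ⁺¹ ⊗id) ((ι₁ᴺ ⊗id) (h (⟦ f ⟧ u)) ++ (ι₂ᴺ ⊗id) (pow∇ n h fⁿv)) ∎
    where
      module M = Module M
      module Mⁿ = Module (power n M)
      ι₁ᴹ : LinearMap M (power (suc n) M)
      ι₁ᴹ = DirectSum.ι₁ M (power n M)
      ι₂ᴹ : LinearMap (power n M) (power (suc n) M)
      ι₂ᴹ = DirectSum.ι₂ M (power n M)
      ι₁ᴺ : LinearMap N (power (suc n) N)
      ι₁ᴺ = DirectSum.ι₁ N (power n N)
      ι₂ᴺ : LinearMap (power n N) (power (suc n) N)
      ι₂ᴺ = DirectSum.ι₂ N (power n N)
      gⁿ⁺¹ : LinearMap (power (suc n) N) (power (suc n) M)
      gⁿ⁺¹ = powₗ (suc n) g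
      fⁿv : Module.Carrierᴹ (power n N)
      fⁿv = powMap n ⟦ f ⟧ v
      open Tensor (power (suc n) M) using (≡⇒≈⊗; ⊗-commutativeMonoid)
      open import Relation.Binary.Reasoning.Setoid (CommutativeMonoid.setoid ⊗-commutativeMonoid)

  module _ {M : Module A m ℓm} where
    open Module M
    open Tensor M
    open import Algebra.Properties.CommutativeMonoid.Sum ⊗-commutativeMonoid
      using () renaming (∑-distrib-+ to ∑⊗-distrib-++; sum-cong-≋ to ∑⊗-cong)

    ∑⊗-·⊗ : ∀ {l} (v : Fin l → TensorC M) a → _·⊗_ M (∑⊗ M v) a ≈ₜ ∑⊗ M (λ j → _·⊗_ M (v j) a)
    ∑⊗-·⊗ v a = sum-homo {M = CommutativeMonoid.monoid ⊗-commutativeMonoid} {N = CommutativeMonoid.monoid ⊗-commutativeMonoid}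
      (record { isMagmaHomomorphism = record { isRelHomomorphism = record { cong = ·⊗-cong a }
                                             ; homo = λ t t' → ≡⇒≈⊗ (·⊗-++ t t' a) }
              ; ε-homo = ⊗-refl }) v

    ∑ᴹ-⊗ : ∀ {l} (v : Fin l → Carrierᴹ) ω → ((∑ᴹ M v , ω) ∷ []) ≈ₜ ∑⊗ M (λ j → (v j , ω) ∷ [])
    ∑ᴹ-⊗ v ω = sum-homo {M = +ᴹ-monoid} {N = CommutativeMonoid.monoid ⊗-commutativeMonoid}
      (record { isMagmaHomomorphism = record { isRelHomomorphism = record { cong = λ e → ⊗-cong e Ω-refl }
                                             ; homo = λ p p' → ⊗-addˡ p p' ω }
              ; ε-homo = ⊗-zeroˡ ω }) v

    grassmann : Coordinates M → Connection M
    grassmann cs = record { ∇ = ∇ ; ∇-cong = ∇-cong ; ∇-add = ∇-add ; ∇-leib = ∇-leib }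
      where
        open Coordinates cs using (len; xs; φs; φ; dual)
        module φ j = LinearMap (φ j)
        ∇ : Carrierᴹ → TensorC M
        ∇ x = ∑⊗ M (λ j → (xs j , d (φs j x)) ∷ [])
        ∇-cong : ∀ {x y} → x ≈ᴹ y → ∇ x ≈ₜ ∇ y
        ∇-cong e = ∑⊗-cong (λ j → ⊗-cong ≈ᴹ-refl (Ω-cong R.refl (φ.⟦⟧-cong j e)))
        ∇-add : ∀ x y → ∇ (x +ᴹ y) ≈ₜ ∇ x ++ ∇ y
        ∇-add x y = ⊗-trans
          (∑⊗-cong (λ j → ⊗-trans (⊗-cong ≈ᴹ-refl (Ω-trans (Ω-cong R.refl (φ.+ᴹ-homo j x y)) (Ω-addʳ 1# _ _)))
                                  (⊗-addʳ (xs j) (d (φs j x)) (d (φs j y)))))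
          (∑⊗-distrib-++ (λ j → (xs j , d (φs j x)) ∷ []) (λ j → (xs j , d (φs j y)) ∷ []))
        leibniz-term : ∀ x a j → ((xs j , d (φs j (x *ᵣ a))) ∷ []) ≈ₜ
                                 ((xs j , a ·Ω d (φs j x)) ∷ []) ++ ((xs j *ᵣ φs j x , d a) ∷ [])
        leibniz-term x a j = begin
          (xs j , d (φs j (x *ᵣ a))) ∷ []
            ≈⟨ ⊗-cong ≈ᴹ-refl (Ω-trans (Ω-cong R.refl (φ.*ᵣ-homo j x a)) (Ω-leib 1# (φs j x) a)) ⟩
          (xs j , (1# * φs j x , a) ∷ (1# * a , φs j x) ∷ []) ∷ []
            ≈⟨ ⊗-trans (⊗-addʳ (xs j) ((1# * φs j x , a) ∷ []) ((1# * a , φs j x) ∷ []))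
                       (⊗-comm ((xs j , (1# * φs j x , a) ∷ []) ∷ []) ((xs j , (1# * a , φs j x) ∷ []) ∷ [])) ⟩
          (xs j , (1# * a , φs j x) ∷ []) ∷ (xs j , (1# * φs j x , a) ∷ []) ∷ []
            ≈⟨ ⊗-++ (⊗-cong ≈ᴹ-refl (Ω-cong (R.*-comm 1# a) R.refl))
                    (⊗-sym (⊗-trans (⊗-bal (φs j x) (xs j) (d a)) (⊗-cong ≈ᴹ-refl (Ω-cong (R.*-comm _ 1#) R.refl)))) ⟩
          ((xs j , a ·Ω d (φs j x)) ∷ []) ++ ((xs j *ᵣ φs j x , d a) ∷ []) ∎
          where open import Relation.Binary.Reasoning.Setoid (CommutativeMonoid.setoid ⊗-commutativeMonoid)
        ∇-leib : ∀ x a → ∇ (x *ᵣ a) ≈ₜ _·⊗_ M (∇ x) a ++ ((x , d a) ∷ [])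
        ∇-leib x a = begin
          ∑⊗ M (λ j → (xs j , d (φs j (x *ᵣ a))) ∷ [])
            ≈⟨ ∑⊗-cong (leibniz-term x a) ⟩
          ∑⊗ M (λ j → ((xs j , a ·Ω d (φs j x)) ∷ []) ++ ((xs j *ᵣ φs j x , d a) ∷ []))
            ≈⟨ ∑⊗-distrib-++ (λ j → (xs j , a ·Ω d (φs j x)) ∷ []) (λ j → (xs j *ᵣ φs j x , d a) ∷ []) ⟩
          ∑⊗ M (λ j → (xs j , a ·Ω d (φs j x)) ∷ []) ++ ∑⊗ M (λ j → (xs j *ᵣ φs j x , d a) ∷ [])
            ≈⟨ ⊗-++ (⊗-sym (∑⊗-·⊗ (λ j → (xs j , d (φs j x)) ∷ []) a))
                    (⊗-trans (⊗-sym (∑ᴹ-⊗ (λ j → xs j *ᵣ φs j x) (d a))) (⊗-cong (≈ᴹ-sym (dual x)) Ω-refl)) ⟩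
          _·⊗_ M (∇ x) a ++ ((x , d a) ∷ []) ∎
          where open import Relation.Binary.Reasoning.Setoid (CommutativeMonoid.setoid ⊗-commutativeMonoid)

  infixr 6 _⊕ₗ_ _⊕ᵢ_

  _⊕ₗ_ : {M M' N N' : Module A m ℓm} → LinearMap M N → LinearMap M' N' → LinearMap (M ⊕ M') (N ⊕ N')
  f ⊕ₗ f' = record { ⟦_⟧ = λ (u , u') → ⟦ f ⟧ u , ⟦ f' ⟧ u' ; isLinear = record
    { ⟦⟧-cong = λ (e , e') → F.⟦⟧-cong e , F'.⟦⟧-cong e'
    ; +ᴹ-homo = λ (x , x') (y , y') → F.+ᴹ-homo x y , F'.+ᴹ-homo x' y'
    ; *ᵣ-homo = λ (x , x') a → F.*ᵣ-homo x a , F'.*ᵣ-homo x' a } }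
    where
      module F = LinearMap f
      module F' = LinearMap f'

  _⊕ᵢ_ : {M M' N N' : Module A m ℓm} → LinearIso M N → LinearIso M' N' → LinearIso (M ⊕ M') (N ⊕ N')
  α ⊕ᵢ α' = record
    { to      = α.to ⊕ₗ α'.to
    ; from    = α.from ⊕ₗ α'.from
    ; to∘from = λ (y , y') → α.to∘from y , α'.to∘from y'
    ; from∘to = λ (x , x') → α.from∘to x , α'.from∘to x' }
    where
      module α = LinearIso α
      module α' = LinearIso α'

  module Zip (M M' : Module A m ℓm) where
    private
      module Mⁿ n = Module (power n M)
      module M'ⁿ n = Module (power n M')
      W : ℕ → Module A m ℓm
      W n = power n M ⊕ power n M'

    zip-linear : ∀ n → IsLinear (W n) (power n (M ⊕ M')) (λ w → zipPow n (proj₁ w) (proj₂ w))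
    zip-linear zero    = record { ⟦⟧-cong = λ _ → tt ; +ᴹ-homo = λ _ _ → tt ; *ᵣ-homo = λ _ _ → tt }
    zip-linear (suc n) = record
      { ⟦⟧-cong = λ ((e , es) , (e' , es')) → (e , e') , Z.⟦⟧-cong (es , es')
      ; +ᴹ-homo = λ ((x , xs) , (x' , xs')) ((y , ys) , (y' , ys')) →
                    (Module.≈ᴹ-refl M , Module.≈ᴹ-refl M') , Z.+ᴹ-homo (xs , xs') (ys , ys')
      ; *ᵣ-homo = λ ((x , xs) , (x' , xs')) a → (Module.≈ᴹ-refl M , Module.≈ᴹ-refl M') , Z.*ᵣ-homo (xs , xs') a }
      where module Z = IsLinear (zip-linear n)

    unzip-linear : ∀ n → IsLinear (power n (M ⊕ M')) (W n) (unzipPow n)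
    unzip-linear zero    = record { ⟦⟧-cong = λ _ → tt , tt ; +ᴹ-homo = λ _ _ → tt , tt ; *ᵣ-homo = λ _ _ → tt , tt }
    unzip-linear (suc n) = record
      { ⟦⟧-cong = λ ((e , e') , es) → (e , proj₁ (U.⟦⟧-cong es)) , (e' , proj₂ (U.⟦⟧-cong es))
      ; +ᴹ-homo = λ (_ , xs) (_ , ys) → (Module.≈ᴹ-refl M , proj₁ (U.+ᴹ-homo xs ys)) , (Module.≈ᴹ-refl M' , proj₂ (U.+ᴹ-homo xs ys))
      ; *ᵣ-homo = λ (_ , xs) a → (Module.≈ᴹ-refl M , proj₁ (U.*ᵣ-homo xs a)) , (Module.≈ᴹ-refl M' , proj₂ (U.*ᵣ-homo xs a)) }
      where module U = IsLinear (unzip-linear n)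

    zip∘unzip : ∀ n z → Module._≈ᴹ_ (power n (M ⊕ M')) (zipPow n (proj₁ (unzipPow n z)) (proj₂ (unzipPow n z))) z
    zip∘unzip zero    z        = tt
    zip∘unzip (suc n) (_ , zs) = (Module.≈ᴹ-refl M , Module.≈ᴹ-refl M') , zip∘unzip n zs

    unzip∘zip : ∀ n u u' → Module._≈ᴹ_ (W n) (unzipPow n (zipPow n u u')) (u , u')
    unzip∘zip zero    u        u'         = tt , tt
    unzip∘zip (suc n) (_ , us) (_ , us') =
      (Module.≈ᴹ-refl M , proj₁ (unzip∘zip n us us')) , (Module.≈ᴹ-refl M' , proj₂ (unzip∘zip n us us'))

    zipᵢ : ∀ n → LinearIso (W n) (power n (M ⊕ M'))
    zipᵢ n = record
      { to      = record { ⟦_⟧ = λ w → zipPow n (proj₁ w) (proj₂ w) ; isLinear = zip-linear n }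
      ; from    = record { ⟦_⟧ = unzipPow n ; isLinear = unzip-linear n }
      ; to∘from = zip∘unzip n
      ; from∘to = λ (u , u') → unzip∘zip n u u' }

    powMap-proj₁-zip : ∀ n u u' → powMap n {M ⊕ M'} {M} proj₁ (zipPow n {M = M} {M'} u u') ≡ u
    powMap-proj₁-zip zero    u        u'         = refl
    powMap-proj₁-zip (suc n) (x , us) (_ , us') = ≡.cong (x ,_) (powMap-proj₁-zip n us us')

    powMap-proj₂-zip : ∀ n u u' → powMap n {M ⊕ M'} {M'} proj₂ (zipPow n {M = M} {M'} u u') ≡ u'
    powMap-proj₂-zip zero    u        u'         = refl
    powMap-proj₂-zip (suc n) (_ , us) (x , us') = ≡.cong (x ,_) (powMap-proj₂-zip n us us')

    unzip-powMap-ι₁ : ∀ n v → Module._≈ᴹ_ (W n) (unzipPow n {M} {M'} (powMap n {M} {M ⊕ M'} (λ u → u , Module.0ᴹ M') v))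
                                            (v , Module.0ᴹ (power n M'))
    unzip-powMap-ι₁ zero    v        = tt , tt
    unzip-powMap-ι₁ (suc n) (_ , vs) =
      (Module.≈ᴹ-refl M , proj₁ (unzip-powMap-ι₁ n vs)) , (Module.≈ᴹ-refl M' , proj₂ (unzip-powMap-ι₁ n vs))

    unzip-powMap-ι₂ : ∀ n v → Module._≈ᴹ_ (W n) (unzipPow n {M} {M'} (powMap n {M'} {M ⊕ M'} (λ u' → Module.0ᴹ M , u') v))
                                            (Module.0ᴹ (power n M) , v)
    unzip-powMap-ι₂ zero    v        = tt , tt
    unzip-powMap-ι₂ (suc n) (_ , vs) =
      (Module.≈ᴹ-refl M , proj₁ (unzip-powMap-ι₂ n vs)) , (Module.≈ᴹ-refl M' , proj₂ (unzip-powMap-ι₂ n vs))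

    open Power using (power-connection)
    open DirectSum using (_⊕ᶜ_; ι₁; ι₂; π₁; π₂)

    pullback-zip-power-⊕ᶜ : ∀ n (C : Connection M) (C' : Connection M') w →
      _≈⊗_ (W n) (Connection.∇ (pullback (zipᵢ n) (power-connection (M ⊕ M') n (_⊕ᶜ_ M M' C C'))) w)
                 (Connection.∇ (_⊕ᶜ_ (power n M) (power n M') (power-connection M n C) (power-connection M' n C')) w)
    pullback-zip-power-⊕ᶜ n C C' (u , u') = begin
      (unzip ⊗id) (pow∇ n {M ⊕ M'} (λ x → h₁ x ++ h₂ x) z)
        ≈⟨ ⊗id-cong unzip (Power.pow∇-++ (M ⊕ M') n h₁ h₂ z) ⟩
      (unzip ⊗id) (pow∇ n {M ⊕ M'} h₁ z ++ pow∇ n {M ⊕ M'} h₂ z)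
        ≈⟨ ⊗id-cong unzip (⊗-++ (pow∇-natural n (π₁ M M') (ι₁ M M') ∇ z) (pow∇-natural n (π₂ M M') (ι₂ M M') ∇' z)) ⟩
      (unzip ⊗id) ((powₗ n (ι₁ M M') ⊗id) (pow∇ n {M} ∇ (powMap n {M ⊕ M'} {M} proj₁ z)) ++
                   (powₗ n (ι₂ M M') ⊗id) (pow∇ n {M'} ∇' (powMap n {M ⊕ M'} {M'} proj₂ z)))
        ≡⟨ ≡.cong₂ (λ v v' → (unzip ⊗id) ((powₗ n (ι₁ M M') ⊗id) (pow∇ n {M} ∇ v) ++ (powₗ n (ι₂ M M') ⊗id) (pow∇ n {M'} ∇' v')))
                   (powMap-proj₁-zip n u u') (powMap-proj₂-zip n u u') ⟩
      (unzip ⊗id) ((powₗ n (ι₁ M M') ⊗id) (pow∇ n {M} ∇ u) ++ (powₗ n (ι₂ M M') ⊗id) (pow∇ n {M'} ∇' u'))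
        ≡⟨ ≡.trans (⊗id-++ unzip ((powₗ n (ι₁ M M') ⊗id) (pow∇ n {M} ∇ u)) ((powₗ n (ι₂ M M') ⊗id) (pow∇ n {M'} ∇' u')))
                   (≡.cong₂ _++_ (⊗id-∘ unzip (powₗ n (ι₁ M M')) (pow∇ n {M} ∇ u)) (⊗id-∘ unzip (powₗ n (ι₂ M M')) (pow∇ n {M'} ∇' u'))) ⟩
      ((unzip ∘ₗ powₗ n (ι₁ M M')) ⊗id) (pow∇ n {M} ∇ u) ++ ((unzip ∘ₗ powₗ n (ι₂ M M')) ⊗id) (pow∇ n {M'} ∇' u')
        ≈⟨ ⊗-++ (⊗id-pointwise {f = unzip ∘ₗ powₗ n (ι₁ M M')} {g = ι₁ (power n M) (power n M')} (unzip-powMap-ι₁ n) (pow∇ n {M} ∇ u))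
                (⊗id-pointwise {f = unzip ∘ₗ powₗ n (ι₂ M M')} {g = ι₂ (power n M) (power n M')} (unzip-powMap-ι₂ n) (pow∇ n {M'} ∇' u')) ⟩
      (ι₁ (power n M) (power n M') ⊗id) (pow∇ n {M} ∇ u) ++ (ι₂ (power n M) (power n M') ⊗id) (pow∇ n {M'} ∇' u') ∎
      where
        open Connection C using (∇)
        open Connection C' using () renaming (∇ to ∇')
        z : Module.Carrierᴹ (power n (M ⊕ M'))
        z = zipPow n {M} {M'} u u'
        unzip : LinearMap (power n (M ⊕ M')) (W n)
        unzip = LinearIso.from (zipᵢ n)
        h₁ : Module.Carrierᴹ (M ⊕ M') → TensorC (M ⊕ M')
        h₁ x = (ι₁ M M' ⊗id) (∇ (proj₁ x))
        h₂ : Module.Carrierᴹ (M ⊕ M') → TensorC (M ⊕ M')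
        h₂ x = (ι₂ M M' ⊗id) (∇' (proj₂ x))
        open Tensor (W n) using (⊗-commutativeMonoid)
        open import Relation.Binary.Reasoning.Setoid (CommutativeMonoid.setoid ⊗-commutativeMonoid)

  from-square : {X : Module A m ℓm} {Y : Module A m' ℓm'} {Z : Module A m'' ℓm''} {W : Module A m‴ ℓm‴}
                (a : LinearIso X Y) (b : LinearIso Y W) (c : LinearIso X Z) (e : LinearIso Z W) →
                (∀ x → Module._≈ᴹ_ W (⟦ LinearIso.to b ⟧ (⟦ LinearIso.to a ⟧ x)) (⟦ LinearIso.to e ⟧ (⟦ LinearIso.to c ⟧ x))) →
                ∀ w → Module._≈ᴹ_ X (⟦ LinearIso.from a ⟧ (⟦ LinearIso.from b ⟧ w)) (⟦ LinearIso.from c ⟧ (⟦ LinearIso.from e ⟧ w))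
  from-square {X = X} {Y} {W = W} a b c e square w = begin
    a⁻¹ (b⁻¹ w)              ≈⟨ LinearMap.⟦⟧-cong (LinearIso.from a) (LinearMap.⟦⟧-cong (LinearIso.from b) (W.≈ᴹ-sym b∘a[u]≈w)) ⟩
    a⁻¹ (b⁻¹ (b∘a u))        ≈⟨ LinearMap.⟦⟧-cong (LinearIso.from a) (LinearIso.from∘to b (⟦ LinearIso.to a ⟧ u)) ⟩
    a⁻¹ (⟦ LinearIso.to a ⟧ u) ≈⟨ LinearIso.from∘to a u ⟩
    u                        ∎
    where
      module W = Module W
      a⁻¹ : Module.Carrierᴹ Y → Module.Carrierᴹ X
      a⁻¹ = ⟦ LinearIso.from a ⟧
      b⁻¹ : W.Carrierᴹ → Module.Carrierᴹ Y
      b⁻¹ = ⟦ LinearIso.from b ⟧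
      b∘a : Module.Carrierᴹ X → W.Carrierᴹ
      b∘a x = ⟦ LinearIso.to b ⟧ (⟦ LinearIso.to a ⟧ x)
      u : Module.Carrierᴹ X
      u = ⟦ LinearIso.from c ⟧ (⟦ LinearIso.from e ⟧ w)
      b∘a[u]≈w : b∘a u W.≈ᴹ w
      b∘a[u]≈w = W.≈ᴹ-trans (square u)
        (W.≈ᴹ-trans (LinearMap.⟦⟧-cong (LinearIso.to e) (LinearIso.to∘from c _)) (LinearIso.to∘from e w))
      open import Relation.Binary.Reasoning.Setoid (Module.≈ᴹ-setoid X)

  module _ {M : Module A m ℓm} {N : Module A m' ℓm'} (α : LinearIso M N) where
    private
      module α = LinearIso α
      module M = Module M
      module TM = Tensor M
      module TN = Tensor N
      module GM = AbelianGroup (⊗-abelianGroup M)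
    open import Relation.Binary.Reasoning.Setoid GM.setoid

    dlog : Connection M → Connection N → M.Carrierᴹ → TensorC M
    dlog C C' x = (α.from ⊗id) (Connection.∇ C' (⟦ α.to ⟧ x) ++ neg⊗ N ((α.to ⊗id) (Connection.∇ C x)))

    dlog-linear : ∀ C C' → IsLinear⊗ M M (dlog C C')
    dlog-linear C C' =
      ⊗id-linear⊗ (connection-difference-linear α.to (connection-∘ α.to C') (⊗id-connection α.to C)) α.from

    dlog≈ : ∀ C C' x → dlog C C' x TM.≈ₜ (α.from ⊗id) (Connection.∇ C' (⟦ α.to ⟧ x)) ++ neg⊗ M (Connection.∇ C x)
    dlog≈ C C' x = begin
      (α.from ⊗id) (a ++ neg⊗ N ((α.to ⊗id) b))
        ≡⟨ ⊗id-++ α.from a (neg⊗ N ((α.to ⊗id) b)) ⟩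
      (α.from ⊗id) a ++ (α.from ⊗id) (neg⊗ N ((α.to ⊗id) b))
        ≈⟨ ⊗-++ ⊗-refl (⊗-trans (⊗id-neg α.from ((α.to ⊗id) b)) (neg⊗-cong (α.⊗id-from∘to b))) ⟩
      (α.from ⊗id) a ++ neg⊗ M b ∎
      where
        a : TensorC N
        a = Connection.∇ C' (⟦ α.to ⟧ x)
        b : TensorC M
        b = Connection.∇ C x

    dlog-cong : ∀ {C₁ C₂ C₁' C₂'} → (∀ x → Connection.∇ C₁ x TM.≈ₜ Connection.∇ C₂ x) →
                (∀ y → Connection.∇ C₁' y TN.≈ₜ Connection.∇ C₂' y) → ∀ x → dlog C₁ C₁' x TM.≈ₜ dlog C₂ C₂' x
    dlog-cong ∇≈ ∇'≈ x = ⊗id-cong α.from (⊗-++ (∇'≈ (⟦ α.to ⟧ x)) (neg⊗-cong (⊗id-cong α.to (∇≈ x))))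

    dlog-change : ∀ C₁ C₂ C₁' C₂' x →
      dlog C₂ C₂' x TM.≈ₜ dlog C₁ C₁' x ++ ((α.from ⊗id) (Connection.∇ C₂' (⟦ α.to ⟧ x) ++ neg⊗ N (Connection.∇ C₁' (⟦ α.to ⟧ x)))
                                            ++ neg⊗ M (Connection.∇ C₂ x ++ neg⊗ M (Connection.∇ C₁ x)))
    dlog-change C₁ C₂ C₁' C₂' x = begin
      dlog C₂ C₂' x
        ≈⟨ dlog≈ C₂ C₂' x ⟩
      F a₂ GM.- b₂
        ≈⟨ [u-v]∙[[x-u]-[y-v]]≈x-y (⊗-abelianGroup M) (F a₁) b₁ (F a₂) b₂ ⟨
      (F a₁ GM.- b₁) ++ ((F a₂ GM.- F a₁) GM.- (b₂ GM.- b₁))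
        ≈⟨ ⊗-++ (⊗-sym (dlog≈ C₁ C₁' x)) (⊗-++ F-difference ⊗-refl) ⟩
      dlog C₁ C₁' x ++ (F (a₂ ++ neg⊗ N a₁) ++ neg⊗ M (b₂ ++ neg⊗ M b₁)) ∎
      where
        F : TensorC N → TensorC M
        F = α.from ⊗id
        a₁ a₂ : TensorC N
        a₁ = Connection.∇ C₁' (⟦ α.to ⟧ x)
        a₂ = Connection.∇ C₂' (⟦ α.to ⟧ x)
        b₁ b₂ : TensorC M
        b₁ = Connection.∇ C₁ x
        b₂ = Connection.∇ C₂ x
        F-difference : F a₂ ++ neg⊗ M (F a₁) TM.≈ₜ F (a₂ ++ neg⊗ N a₁)
        F-difference = ⊗-sym (⊗id-difference α.from a₂ a₁)

  module _ {P Q R : Module A m ℓm} (α : LinearIso P Q) (β : LinearIso Q R) (γ : LinearIso P R)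
           (γ≈β∘α : ∀ x → Module._≈ᴹ_ R (⟦ LinearIso.to γ ⟧ x) (⟦ LinearIso.to β ⟧ (⟦ LinearIso.to α ⟧ x))) where
    private
      module α = LinearIso α
      module β = LinearIso β
      module γ = LinearIso γ
      module TP = Tensor P
      module GP = AbelianGroup (⊗-abelianGroup P)
    open import Relation.Binary.Reasoning.Setoid GP.setoid

    dlog-∘ : ∀ CP CQ CR x → dlog γ CP CR x TP.≈ₜ (α.from ⊗id) (dlog β CQ CR (⟦ α.to ⟧ x)) ++ dlog α CP CQ x
    dlog-∘ CP CQ CR x = begin
      dlog γ CP CR x
        ≈⟨ dlog≈ γ CP CR x ⟩
      (γ.from ⊗id) (∇R (⟦ γ.to ⟧ x)) GP.- ∇P x
        ≈⟨ ⊗-++ γ⁻¹∇R≈ ⊗-refl ⟩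
      (α.from ⊗id) ((β.from ⊗id) (∇R βαx)) GP.- ∇P x
        ≈⟨ [x-y]∙[y-z]≈x-z (⊗-abelianGroup P) ((α.from ⊗id) ((β.from ⊗id) (∇R βαx))) ((α.from ⊗id) (∇Q (⟦ α.to ⟧ x))) (∇P x) ⟨
      ((α.from ⊗id) ((β.from ⊗id) (∇R βαx)) GP.- (α.from ⊗id) (∇Q (⟦ α.to ⟧ x))) ++ ((α.from ⊗id) (∇Q (⟦ α.to ⟧ x)) GP.- ∇P x)
        ≈⟨ ⊗-++ (⊗-sym (⊗id-difference α.from ((β.from ⊗id) (∇R βαx)) (∇Q (⟦ α.to ⟧ x)))) (⊗-sym (dlog≈ α CP CQ x)) ⟩
      (α.from ⊗id) ((β.from ⊗id) (∇R βαx) GQ.- ∇Q (⟦ α.to ⟧ x)) ++ dlog α CP CQ x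
        ≈⟨ ⊗-++ (⊗id-cong α.from (⊗-sym (dlog≈ β CQ CR (⟦ α.to ⟧ x)))) ⊗-refl ⟩
      (α.from ⊗id) (dlog β CQ CR (⟦ α.to ⟧ x)) ++ dlog α CP CQ x ∎
      where
        module GQ = AbelianGroup (⊗-abelianGroup Q)
        open Connection CP using () renaming (∇ to ∇P)
        open Connection CQ using () renaming (∇ to ∇Q)
        open Connection CR using () renaming (∇ to ∇R; ∇-cong to ∇R-cong)
        βαx : Module.Carrierᴹ R
        βαx = ⟦ β.to ⟧ (⟦ α.to ⟧ x)
        γ⁻¹≈α⁻¹β⁻¹ : ∀ w → Module._≈ᴹ_ P (⟦ γ.from ⟧ w) (⟦ α.from ⟧ (⟦ β.from ⟧ w))
        γ⁻¹≈α⁻¹β⁻¹ w = Module.≈ᴹ-sym P (from-square α β γ idᵢ (λ x → Module.≈ᴹ-sym R (γ≈β∘α x)) w)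
        γ⁻¹∇R≈ : (γ.from ⊗id) (∇R (⟦ γ.to ⟧ x)) TP.≈ₜ (α.from ⊗id) ((β.from ⊗id) (∇R βαx))
        γ⁻¹∇R≈ = ⊗-trans (⊗id-cong γ.from (∇R-cong (γ≈β∘α x)))
                 (⊗-trans (⊗id-pointwise {f = γ.from} {g = α.from ∘ₗ β.from} γ⁻¹≈α⁻¹β⁻¹ (∇R βαx))
                          (TP.≡⇒≈⊗ (≡.sym (⊗id-∘ α.from β.from (∇R βαx)))))

  module _ {M M' N N' : Module A m ℓm} (f : LinearIso M M') (g : LinearIso N N') (α : LinearIso M N) (α' : LinearIso M' N')
           (g∘α≈α'∘f : ∀ x → Module._≈ᴹ_ N' (⟦ LinearIso.to g ⟧ (⟦ LinearIso.to α ⟧ x)) (⟦ LinearIso.to α' ⟧ (⟦ LinearIso.to f ⟧ x))) where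
    private
      module f = LinearIso f
      module g = LinearIso g
      module α = LinearIso α
      module α' = LinearIso α'
      module TM = Tensor M
      module GM = AbelianGroup (⊗-abelianGroup M)
    open import Relation.Binary.Reasoning.Setoid GM.setoid

    dlog-natural : ∀ C C' x → dlog α (pullback f C) (pullback g C') x TM.≈ₜ (f.from ⊗id) (dlog α' C C' (⟦ f.to ⟧ x))
    dlog-natural C C' x = begin
      dlog α (pullback f C) (pullback g C') x
        ≈⟨ dlog≈ α (pullback f C) (pullback g C') x ⟩
      (α.from ⊗id) ((g.from ⊗id) (∇' (⟦ g.to ⟧ (⟦ α.to ⟧ x)))) GM.- (f.from ⊗id) (∇ fx)
        ≈⟨ ⊗-++ α⁻¹g⁻¹∇'≈ ⊗-refl ⟩
      (f.from ⊗id) ((α'.from ⊗id) (∇' (⟦ α'.to ⟧ fx))) GM.- (f.from ⊗id) (∇ fx)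
        ≈⟨ ⊗id-difference f.from ((α'.from ⊗id) (∇' (⟦ α'.to ⟧ fx))) (∇ fx) ⟨
      (f.from ⊗id) ((α'.from ⊗id) (∇' (⟦ α'.to ⟧ fx)) ++ neg⊗ M' (∇ fx))
        ≈⟨ ⊗id-cong f.from (⊗-sym (dlog≈ α' C C' fx)) ⟩
      (f.from ⊗id) (dlog α' C C' fx) ∎
      where
        open Connection C using (∇)
        open Connection C' using () renaming (∇ to ∇'; ∇-cong to ∇'-cong)
        fx : Module.Carrierᴹ M'
        fx = ⟦ f.to ⟧ x
        α⁻¹g⁻¹∇'≈ : (α.from ⊗id) ((g.from ⊗id) (∇' (⟦ g.to ⟧ (⟦ α.to ⟧ x)))) TM.≈ₜ (f.from ⊗id) ((α'.from ⊗id) (∇' (⟦ α'.to ⟧ fx)))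
        α⁻¹g⁻¹∇'≈ = ⊗-trans (TM.≡⇒≈⊗ (⊗id-∘ α.from g.from (∇' (⟦ g.to ⟧ (⟦ α.to ⟧ x)))))
                   (⊗-trans (⊗id-cong (α.from ∘ₗ g.from) (∇'-cong (g∘α≈α'∘f x)))
                   (⊗-trans (⊗id-pointwise {f = α.from ∘ₗ g.from} {g = f.from ∘ₗ α'.from} (from-square α g f α' g∘α≈α'∘f) (∇' (⟦ α'.to ⟧ fx)))
                            (TM.≡⇒≈⊗ (≡.sym (⊗id-∘ f.from α'.from (∇' (⟦ α'.to ⟧ fx)))))))

  module _ {P P' Q Q' : Module A m ℓm} (α : LinearIso P Q) (α' : LinearIso P' Q') where
    open DirectSum using (_⊕ᶜ_; ι₁; ι₂)
    private
      module α = LinearIso α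
      module α' = LinearIso α'
      module PP' = Module (P ⊕ P')
      module TPP' = Tensor (P ⊕ P')
      module GPP' = AbelianGroup (⊗-abelianGroup (P ⊕ P'))
    open import Relation.Binary.Reasoning.Setoid GPP'.setoid

    dlog-⊕ : ∀ C₁ C₂ C₁' C₂' u u' →
             dlog (α ⊕ᵢ α') (_⊕ᶜ_ P P' C₁ C₂) (_⊕ᶜ_ Q Q' C₁' C₂') (u , u') TPP'.≈ₜ
             (ι₁ P P' ⊗id) (dlog α C₁ C₁' u) ++ (ι₂ P P' ⊗id) (dlog α' C₂ C₂' u')
    dlog-⊕ C₁ C₂ C₁' C₂' u u' = begin
      dlog (α ⊕ᵢ α') (_⊕ᶜ_ P P' C₁ C₂) (_⊕ᶜ_ Q Q' C₁' C₂') (u , u')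
        ≈⟨ dlog≈ (α ⊕ᵢ α') (_⊕ᶜ_ P P' C₁ C₂) (_⊕ᶜ_ Q Q' C₁' C₂') (u , u') ⟩
      (F ⊗id) ((ι₁ Q Q' ⊗id) a₁ ++ (ι₂ Q Q' ⊗id) a₂) GPP'.- ((ι₁ P P' ⊗id) b₁ ++ (ι₂ P P' ⊗id) b₂)
        ≈⟨ ⊗-++ F∘ι≈ι∘F ⊗-refl ⟩
      ((ι₁ P P' ⊗id) ((α.from ⊗id) a₁) ++ (ι₂ P P' ⊗id) ((α'.from ⊗id) a₂)) GPP'.- ((ι₁ P P' ⊗id) b₁ ++ (ι₂ P P' ⊗id) b₂)
        ≈⟨ [x∙y]-[u∙v]≈[x-u]∙[y-v] (⊗-abelianGroup (P ⊕ P')) ((ι₁ P P' ⊗id) ((α.from ⊗id) a₁)) ((ι₂ P P' ⊗id) ((α'.from ⊗id) a₂))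
                                   ((ι₁ P P' ⊗id) b₁) ((ι₂ P P' ⊗id) b₂) ⟩
      ((ι₁ P P' ⊗id) ((α.from ⊗id) a₁) GPP'.- (ι₁ P P' ⊗id) b₁) ++ ((ι₂ P P' ⊗id) ((α'.from ⊗id) a₂) GPP'.- (ι₂ P P' ⊗id) b₂)
        ≈⟨ ⊗-++ (⊗-sym (⊗id-difference (ι₁ P P') ((α.from ⊗id) a₁) b₁)) (⊗-sym (⊗id-difference (ι₂ P P') ((α'.from ⊗id) a₂) b₂)) ⟩
      (ι₁ P P' ⊗id) ((α.from ⊗id) a₁ ++ neg⊗ P b₁) ++ (ι₂ P P' ⊗id) ((α'.from ⊗id) a₂ ++ neg⊗ P' b₂)
        ≈⟨ ⊗-++ (⊗id-cong (ι₁ P P') (⊗-sym (dlog≈ α C₁ C₁' u))) (⊗id-cong (ι₂ P P') (⊗-sym (dlog≈ α' C₂ C₂' u'))) ⟩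
      (ι₁ P P' ⊗id) (dlog α C₁ C₁' u) ++ (ι₂ P P' ⊗id) (dlog α' C₂ C₂' u') ∎
      where
        F : LinearMap (Q ⊕ Q') (P ⊕ P')
        F = LinearIso.from (α ⊕ᵢ α')
        a₁ : TensorC Q
        a₁ = Connection.∇ C₁' (⟦ α.to ⟧ u)
        a₂ : TensorC Q'
        a₂ = Connection.∇ C₂' (⟦ α'.to ⟧ u')
        b₁ : TensorC P
        b₁ = Connection.∇ C₁ u
        b₂ : TensorC P'
        b₂ = Connection.∇ C₂ u'
        F∘ι≈ι∘F : (F ⊗id) ((ι₁ Q Q' ⊗id) a₁ ++ (ι₂ Q Q' ⊗id) a₂) TPP'.≈ₜ
                  (ι₁ P P' ⊗id) ((α.from ⊗id) a₁) ++ (ι₂ P P' ⊗id) ((α'.from ⊗id) a₂)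
        F∘ι≈ι∘F = ⊗-trans (TPP'.≡⇒≈⊗ (≡.trans (⊗id-++ F ((ι₁ Q Q' ⊗id) a₁) ((ι₂ Q Q' ⊗id) a₂))
                                              (≡.cong₂ _++_ (⊗id-∘ F (ι₁ Q Q') a₁) (⊗id-∘ F (ι₂ Q Q') a₂))))
                  (⊗-trans (⊗-++ (⊗id-pointwise {f = F ∘ₗ ι₁ Q Q'} {g = ι₁ P P' ∘ₗ α.from}
                                                (λ _ → Module.≈ᴹ-refl P , LinearMap.0ᴹ-homo α'.from) a₁)
                                 (⊗id-pointwise {f = F ∘ₗ ι₂ Q Q'} {g = ι₂ P P' ∘ₗ α'.from}
                                                (λ _ → LinearMap.0ᴹ-homo α.from , Module.≈ᴹ-refl P') a₂))
                           (TPP'.≡⇒≈⊗ (≡.sym (≡.cong₂ _++_ (⊗id-∘ (ι₁ P P') α.from a₁) (⊗id-∘ (ι₂ P P') α'.from a₂)))))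

  module _ {M : Module A m ℓm} {N : Module A m' ℓm'} (csM : Coordinates M) (csN : Coordinates N) (α : LinearIso M N) where
    private
      module α = LinearIso α
      module CM = Coordinates csM
      module CN = Coordinates csN

    tr-conjugate : ∀ {h} → IsLinear⊗ N N h → tr M CM.rawCoord (λ x → (α.from ⊗id) (h (⟦ α.to ⟧ x))) ≈Ω tr N CN.rawCoord h
    tr-conjugate {h} h-linear = Ω-trans (tr-cyclic csM csN α.to (⊗id-linear⊗ h-linear α.from))
                                        (Trace.tr-cong csN (λ y → α.⊗id-to∘from (h y)))

    tr-dlog-change : ∀ C₁ C₂ C₁' C₂' →
      tr M CM.rawCoord (dlog α C₂ C₂') ≈Ω
      tr M CM.rawCoord (dlog α C₁ C₁') ++ (tr N CN.rawCoord (λ y → Connection.∇ C₂' y ++ neg⊗ N (Connection.∇ C₁' y))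
                                           ++ -Ω tr M CM.rawCoord (λ x → Connection.∇ C₂ x ++ neg⊗ M (Connection.∇ C₁ x)))
    tr-dlog-change C₁ C₂ C₁' C₂' = begin
      tr M CM.rawCoord (dlog α C₂ C₂')
        ≈⟨ Trace.tr-cong csM (dlog-change α C₁ C₂ C₁' C₂') ⟩
      tr M CM.rawCoord (λ x → dlog α C₁ C₁' x ++ ((α.from ⊗id) (Θ' (⟦ α.to ⟧ x)) ++ neg⊗ M (Θ x)))
        ≈⟨ Trace.tr-++ csM (dlog α C₁ C₁') (λ x → (α.from ⊗id) (Θ' (⟦ α.to ⟧ x)) ++ neg⊗ M (Θ x)) ⟩
      tr M CM.rawCoord (dlog α C₁ C₁') ++ tr M CM.rawCoord (λ x → (α.from ⊗id) (Θ' (⟦ α.to ⟧ x)) ++ neg⊗ M (Θ x))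
        ≈⟨ Ω-++ Ω-refl (Ω-trans (Trace.tr-++ csM (λ x → (α.from ⊗id) (Θ' (⟦ α.to ⟧ x))) (λ x → neg⊗ M (Θ x)))
                                (Ω-++ (tr-conjugate Θ'-linear) (Trace.tr-neg csM Θ))) ⟩
      tr M CM.rawCoord (dlog α C₁ C₁') ++ (tr N CN.rawCoord Θ' ++ -Ω tr M CM.rawCoord Θ) ∎
      where
        open import Relation.Binary.Reasoning.Setoid Ω-setoid
        Θ' : Module.Carrierᴹ N → TensorC N
        Θ' y = Connection.∇ C₂' y ++ neg⊗ N (Connection.∇ C₁' y)
        Θ : Module.Carrierᴹ M → TensorC M
        Θ x = Connection.∇ C₂ x ++ neg⊗ M (Connection.∇ C₁ x)
        Θ'-linear : IsLinear⊗ N N Θ'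
        Θ'-linear = connection-difference-linear idₗ (connection-along-id C₂') (connection-along-id C₁')

  tr-dlog-∘ : {P Q R : Module A m ℓm} (csP : Coordinates P) (csQ : Coordinates Q)
              (α : LinearIso P Q) (β : LinearIso Q R) (γ : LinearIso P R) →
              (∀ x → Module._≈ᴹ_ R (⟦ LinearIso.to γ ⟧ x) (⟦ LinearIso.to β ⟧ (⟦ LinearIso.to α ⟧ x))) → ∀ CP CQ CR →
              tr P (Coordinates.rawCoord csP) (dlog γ CP CR) ≈Ω
              tr P (Coordinates.rawCoord csP) (dlog α CP CQ) ++ tr Q (Coordinates.rawCoord csQ) (dlog β CQ CR)
  tr-dlog-∘ {P = P} {Q} csP csQ α β γ γ≈β∘α CP CQ CR = begin
    tr P (Coordinates.rawCoord csP) (dlog γ CP CR)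
      ≈⟨ Trace.tr-cong csP (dlog-∘ α β γ γ≈β∘α CP CQ CR) ⟩
    tr P (Coordinates.rawCoord csP) (λ x → (LinearIso.from α ⊗id) (dlog β CQ CR (⟦ LinearIso.to α ⟧ x)) ++ dlog α CP CQ x)
      ≈⟨ Trace.tr-++ csP (λ x → (LinearIso.from α ⊗id) (dlog β CQ CR (⟦ LinearIso.to α ⟧ x))) (dlog α CP CQ) ⟩
    tr P (Coordinates.rawCoord csP) (λ x → (LinearIso.from α ⊗id) (dlog β CQ CR (⟦ LinearIso.to α ⟧ x))) ++
    tr P (Coordinates.rawCoord csP) (dlog α CP CQ)
      ≈⟨ Ω-++ (tr-conjugate csP csQ α (dlog-linear β CQ CR)) Ω-refl ⟩
    tr Q (Coordinates.rawCoord csQ) (dlog β CQ CR) ++ tr P (Coordinates.rawCoord csP) (dlog α CP CQ)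
      ≈⟨ Ω-comm (tr Q (Coordinates.rawCoord csQ) (dlog β CQ CR)) (tr P (Coordinates.rawCoord csP) (dlog α CP CQ)) ⟩
    tr P (Coordinates.rawCoord csP) (dlog α CP CQ) ++ tr Q (Coordinates.rawCoord csQ) (dlog β CQ CR) ∎
    where open import Relation.Binary.Reasoning.Setoid Ω-setoid

  tr-dlog-natural : {M M' N N' : Module A m ℓm} (csM : Coordinates M) (csM' : Coordinates M')
                    (f : LinearIso M M') (g : LinearIso N N') (α : LinearIso M N) (α' : LinearIso M' N') →
                    (∀ x → Module._≈ᴹ_ N' (⟦ LinearIso.to g ⟧ (⟦ LinearIso.to α ⟧ x)) (⟦ LinearIso.to α' ⟧ (⟦ LinearIso.to f ⟧ x))) →
                    ∀ C C' → tr M (Coordinates.rawCoord csM) (dlog α (pullback f C) (pullback g C')) ≈Ω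
                             tr M' (Coordinates.rawCoord csM') (dlog α' C C')
  tr-dlog-natural csM csM' f g α α' square C C' =
    Ω-trans (Trace.tr-cong csM (dlog-natural f g α α' square C C')) (tr-conjugate csM csM' f (dlog-linear α' C C'))

  tr-dlog-⊕ : {P P' Q Q' : Module A m ℓm} (csP : Coordinates P) (csP' : Coordinates P')
              (α : LinearIso P Q) (α' : LinearIso P' Q') → ∀ C₁ C₂ C₁' C₂' →
              tr (P ⊕ P') (DirectSum.⊕-rawCoord P P' (Coordinates.rawCoord csP) (Coordinates.rawCoord csP'))
                 (dlog (α ⊕ᵢ α') (DirectSum._⊕ᶜ_ P P' C₁ C₂) (DirectSum._⊕ᶜ_ Q Q' C₁' C₂')) ≈Ω
              tr P (Coordinates.rawCoord csP) (dlog α C₁ C₁') ++ tr P' (Coordinates.rawCoord csP') (dlog α' C₂ C₂')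
  tr-dlog-⊕ {P = P} {P'} csP csP' α α' C₁ C₂ C₁' C₂' =
    DirectSum.tr-⊕ P P' csP csP' {h₁ = dlog α C₁ C₁'} {h₂ = dlog α' C₂ C₂'} (dlog-⊕ α α' C₁ C₂ C₁' C₂')

  module Triples (m ℓm : Level) (n : ℕ) where
    open Power using (power-connection; power-coordinates)

    module _ (T : Triple m ℓm n) where
      open Triple T

      P-coordinates : Coordinates (power n P)
      P-coordinates = power-coordinates P n (fromIsFGP Pfg)

      Q-coordinates : Coordinates (power n Q)
      Q-coordinates = power-coordinates Q n (fromIsFGP Qfg)

      αᵢ : LinearIso (power n P) (power n Q)
      αᵢ = fromIsModuleIsomorphism α-iso

      D-formula-change : ∀ C₁ C₁' C₂ C₂' → D-formula m ℓm n T C₂ C₂' ≈[mod n ·] D-formula m ℓm n T C₁ C₁'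
      D-formula-change C₁ C₁' C₂ C₂' = ≈∙[×-×]⇒≈[mod·] {n = n} tr-ΔQ tr-ΔP
        (Ω-trans (tr-dlog-change P-coordinates Q-coordinates αᵢ (power-connection P n C₁) (power-connection P n C₂)
                                                               (power-connection Q n C₁') (power-connection Q n C₂'))
                 (Ω-++ (Ω-refl {x = D-formula m ℓm n T C₁ C₁'})
                       (Ω-++ (Power.tr-power-difference Q n (fromIsFGP Qfg) C₁' C₂')
                             (·Ω-congˡ (- 1#) (Power.tr-power-difference P n (fromIsFGP Pfg) C₁ C₂)))))
        where
          tr-ΔQ tr-ΔP : ΩC
          tr-ΔQ = tr Q (IsFGP.coord Qfg) (λ y → Connection.∇ C₂' y ++ neg⊗ Q (Connection.∇ C₁' y))
          tr-ΔP = tr P (IsFGP.coord Pfg) (λ x → Connection.∇ C₂ x ++ neg⊗ P (Connection.∇ C₁ x))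

    P-iso : ∀ {T T'} → TripleIso m ℓm n T T' → LinearIso (Triple.P T) (Triple.P T')
    P-iso i = fromIsModuleIsomorphism (TripleIso.f-iso i)

    Q-iso : ∀ {T T'} → TripleIso m ℓm n T T' → LinearIso (Triple.Q T) (Triple.Q T')
    Q-iso i = fromIsModuleIsomorphism (TripleIso.g-iso i)

    D-formula-iso : ∀ {T T'} (i : TripleIso m ℓm n T T') C C' →
      D-formula m ℓm n T (pullback (P-iso i) C) (pullback (Q-iso i) C') ≈Ω D-formula m ℓm n T' C C'
    D-formula-iso {T} {T'} i C C' = Ω-trans
      (Trace.tr-cong (P-coordinates T)
        (dlog-cong (αᵢ T) {C₁ = power-connection P n (pullback f C)} {C₂ = pullback (powᵢ n f) (power-connection P' n C)}
                          {C₁' = power-connection Q n (pullback g C')} {C₂' = pullback (powᵢ n g) (power-connection Q' n C')}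
                   (pow∇-natural n (LinearIso.to f) (LinearIso.from f) (Connection.∇ C))
                   (pow∇-natural n (LinearIso.to g) (LinearIso.from g) (Connection.∇ C'))))
      (tr-dlog-natural (P-coordinates T) (P-coordinates T') (powᵢ n f) (powᵢ n g) (αᵢ T) (αᵢ T') (TripleIso.comm i)
                       (power-connection P' n C) (power-connection Q' n C'))
      where
        open Triple T using (P; Q)
        open Triple T' using () renaming (P to P'; Q to Q')
        f : LinearIso P P'
        f = P-iso i
        g : LinearIso Q Q'
        g = Q-iso i

    D-formula-comp : ∀ (P Q R : Module A m ℓm) pf qf qf' rf
      (α : Module.Carrierᴹ (power n P) → Module.Carrierᴹ (power n Q)) (αi : IsIso m ℓm n (power n P) (power n Q) α)
      (β : Module.Carrierᴹ (power n Q) → Module.Carrierᴹ (power n R)) (βi : IsIso m ℓm n (power n Q) (power n R) β) CP CQ CR →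
      D-formula m ℓm n (triple P R pf rf (λ x → β (α x)) (Comp.isModuleIsomorphism (Module.≈ᴹ-trans (power n R)) αi βi)) CP CR ≈Ω
      D-formula m ℓm n (triple P Q pf qf α αi) CP CQ ++ D-formula m ℓm n (triple Q R qf' rf β βi) CQ CR
    D-formula-comp P Q R pf qf qf' rf α αi β βi CP CQ CR =
      tr-dlog-∘ (P-coordinates T₁) (P-coordinates T₂) (αᵢ T₁) (αᵢ T₂) (αᵢ T₃) (λ _ → Module.≈ᴹ-refl (power n R))
                (power-connection P n CP) (power-connection Q n CQ) (power-connection R n CR)
      where
        T₁ T₂ T₃ : Triple m ℓm n
        T₁ = triple P Q pf qf α αi
        T₂ = triple Q R qf' rf β βi
        T₃ = triple P R pf rf (λ x → β (α x)) (Comp.isModuleIsomorphism (Module.≈ᴹ-trans (power n R)) αi βi)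

    D-formula-sum : ∀ T T' pf qf iso CP CP' CQ CQ' →
      let open Triple T using (P; Q)
          open Triple T' using () renaming (P to P'; Q to Q') in
      D-formula m ℓm n (triple (P ⊕ P') (Q ⊕ Q') pf qf (sumFun m ℓm n T T') iso)
                       (DirectSum._⊕ᶜ_ P P' CP CP') (DirectSum._⊕ᶜ_ Q Q' CQ CQ') ≈Ω
      D-formula m ℓm n T CP CQ ++ D-formula m ℓm n T' CP' CQ'
    D-formula-sum T T' pf qf iso CP CP' CQ CQ' = begin
      tr (power n (P ⊕ P')) (Coordinates.rawCoord (P-coordinates S))
         (dlog (αᵢ S) (power-connection (P ⊕ P') n CP⊕CP') (power-connection (Q ⊕ Q') n CQ⊕CQ'))
        ≈⟨ tr-dlog-natural W-coordinates (P-coordinates S) (Zip.zipᵢ P P' n) (Zip.zipᵢ Q Q' n) (αᵢ T ⊕ᵢ αᵢ T') (αᵢ S) square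
                           (power-connection (P ⊕ P') n CP⊕CP') (power-connection (Q ⊕ Q') n CQ⊕CQ') ⟨
      tr (power n P ⊕ power n P') (Coordinates.rawCoord W-coordinates)
         (dlog (αᵢ T ⊕ᵢ αᵢ T') (pullback (Zip.zipᵢ P P' n) (power-connection (P ⊕ P') n CP⊕CP'))
                               (pullback (Zip.zipᵢ Q Q' n) (power-connection (Q ⊕ Q') n CQ⊕CQ')))
        ≈⟨ Trace.tr-cong W-coordinates (dlog-cong (αᵢ T ⊕ᵢ αᵢ T')
             {C₁ = pullback (Zip.zipᵢ P P' n) (power-connection (P ⊕ P') n CP⊕CP')}
             {C₂ = DirectSum._⊕ᶜ_ (power n P) (power n P') (power-connection P n CP) (power-connection P' n CP')}
             {C₁' = pullback (Zip.zipᵢ Q Q' n) (power-connection (Q ⊕ Q') n CQ⊕CQ')}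
             {C₂' = DirectSum._⊕ᶜ_ (power n Q) (power n Q') (power-connection Q n CQ) (power-connection Q' n CQ')}
             (Zip.pullback-zip-power-⊕ᶜ P P' n CP CP') (Zip.pullback-zip-power-⊕ᶜ Q Q' n CQ CQ')) ⟩
      tr (power n P ⊕ power n P') (Coordinates.rawCoord W-coordinates)
         (dlog (αᵢ T ⊕ᵢ αᵢ T') (DirectSum._⊕ᶜ_ (power n P) (power n P') (power-connection P n CP) (power-connection P' n CP'))
                               (DirectSum._⊕ᶜ_ (power n Q) (power n Q') (power-connection Q n CQ) (power-connection Q' n CQ')))
        ≈⟨ tr-dlog-⊕ (P-coordinates T) (P-coordinates T') (αᵢ T) (αᵢ T')
                     (power-connection P n CP) (power-connection P' n CP') (power-connection Q n CQ) (power-connection Q' n CQ') ⟩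
      D-formula m ℓm n T CP CQ ++ D-formula m ℓm n T' CP' CQ' ∎
      where
        open Triple T using (P; Q)
        open Triple T' using () renaming (P to P'; Q to Q')
        open import Relation.Binary.Reasoning.Setoid Ω-setoid
        S : Triple m ℓm n
        S = triple (P ⊕ P') (Q ⊕ Q') pf qf (sumFun m ℓm n T T') iso
        CP⊕CP' : Connection (P ⊕ P')
        CP⊕CP' = DirectSum._⊕ᶜ_ P P' CP CP'
        CQ⊕CQ' : Connection (Q ⊕ Q')
        CQ⊕CQ' = DirectSum._⊕ᶜ_ Q Q' CQ CQ'
        W-coordinates : Coordinates (power n P ⊕ power n P')
        W-coordinates = DirectSum.⊕-coordinates (power n P) (power n P') (P-coordinates T) (P-coordinates T')
        square : ∀ w → Module._≈ᴹ_ (power n (Q ⊕ Q'))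
                         (⟦ LinearIso.to (Zip.zipᵢ Q Q' n) ⟧ (⟦ LinearIso.to (αᵢ T ⊕ᵢ αᵢ T') ⟧ w))
                         (⟦ LinearIso.to (αᵢ S) ⟧ (⟦ LinearIso.to (Zip.zipᵢ P P' n) ⟧ w))
        square (u , u') = Module.≈ᴹ-sym (power n (Q ⊕ Q')) (IsLinear.⟦⟧-cong (Zip.zip-linear Q Q' n)
          (LinearMap.⟦⟧-cong (LinearIso.to (αᵢ T)) (proj₁ (Zip.unzip∘zip P P' n u u')) ,
           LinearMap.⟦⟧-cong (LinearIso.to (αᵢ T')) (proj₂ (Zip.unzip∘zip P P' n u u'))))

    grassmannᴾ : (T : Triple m ℓm n) → Connection (Triple.P T)
    grassmannᴾ T = grassmann (fromIsFGP (Triple.Pfg T))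

    grassmannᵠ : (T : Triple m ℓm n) → Connection (Triple.Q T)
    grassmannᵠ T = grassmann (fromIsFGP (Triple.Qfg T))

    Dₜ : Triple m ℓm n → ΩC
    Dₜ T = D-formula m ℓm n T (grassmannᴾ T) (grassmannᵠ T)

    D : K1C m ℓm n → ΩC
    D []                 = []
    D ((true  , T) ∷ xs) = Dₜ T ++ D xs
    D ((false , T) ∷ xs) = -Ω Dₜ T ++ D xs

    D-++ : ∀ xs ys → D (xs ++ ys) ≈Ω D xs ++ D ys
    D-++ []                 ys = Ω-refl
    D-++ ((true  , T) ∷ xs) ys = Ω-trans (Ω-++ Ω-refl (D-++ xs ys)) (Ω-sym (≡⇒≈Ω (++-assoc (Dₜ T) (D xs) (D ys))))
    D-++ ((false , T) ∷ xs) ys = Ω-trans (Ω-++ Ω-refl (D-++ xs ys)) (Ω-sym (≡⇒≈Ω (++-assoc (-Ω Dₜ T) (D xs) (D ys))))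

    D-[_] : ∀ T → D ([_] m ℓm n T) ≈Ω Dₜ T
    D-[ T ] = ≡⇒≈Ω (++-identityʳ (Dₜ T))

    Dₜ≈D-formula : ∀ T C C' → Dₜ T ≈[mod n ·] D-formula m ℓm n T C C'
    Dₜ≈D-formula T C C' = D-formula-change T C C' (grassmannᴾ T) (grassmannᵠ T)

    D-[]≈D-formula : ∀ T C C' → D ([_] m ℓm n T) ≈[mod n ·] D-formula m ℓm n T C C'
    D-[]≈D-formula T C C' = ≈[mod·]-trans (≈⇒≈[mod·] D-[ T ]) (Dₜ≈D-formula T C C')

    D-resp-~K : ∀ {xs ys} → _~K_ m ℓm n xs ys → D xs ≈[mod n ·] D ys
    D-resp-~K K-refl          = ≈[mod·]-refl
    D-resp-~K (K-sym e)       = ≈[mod·]-sym (D-resp-~K e)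
    D-resp-~K (K-trans e e')  = ≈[mod·]-trans (D-resp-~K e) (D-resp-~K e')
    D-resp-~K (K-++ {xs} {xs'} {ys} {ys'} e e') =
      ≈[mod·]-trans (≈⇒≈[mod·] (D-++ xs ys))
        (≈[mod·]-trans (∙-cong-≈[mod·] (D-resp-~K e) (D-resp-~K e')) (≈⇒≈[mod·] (Ω-sym (D-++ xs' ys'))))
    D-resp-~K (K-comm xs ys)  = ≈⇒≈[mod·] (Ω-trans (D-++ xs ys) (Ω-trans (Ω-comm (D xs) (D ys)) (Ω-sym (D-++ ys xs))))
    D-resp-~K (K-inv T)       = ≈⇒≈[mod·] (Ω-trans (Ω-++ Ω-refl (≡⇒≈Ω (++-identityʳ (-Ω Dₜ T)))) (-Ω‿inverseʳ (Dₜ T)))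
    D-resp-~K (K-iso {T} {T'} i) =
      ≈[mod·]-trans (D-[]≈D-formula T (pullback (P-iso i) (grassmannᴾ T')) (pullback (Q-iso i) (grassmannᵠ T')))
                    (≈⇒≈[mod·] (Ω-trans (D-formula-iso i (grassmannᴾ T') (grassmannᵠ T')) (Ω-sym D-[ T' ])))
    D-resp-~K (K-sum T T' pf qf iso) =
      ≈[mod·]-trans (D-[]≈D-formula S (DirectSum._⊕ᶜ_ P P' (grassmannᴾ T) (grassmannᴾ T'))
                                      (DirectSum._⊕ᶜ_ Q Q' (grassmannᵠ T) (grassmannᵠ T')))
                    (≈⇒≈[mod·] (Ω-trans (D-formula-sum T T' pf qf iso (grassmannᴾ T) (grassmannᴾ T') (grassmannᵠ T) (grassmannᵠ T'))
                                        (Ω-++ Ω-refl (Ω-sym D-[ T' ]))))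
      where
        open Triple T using (P; Q)
        open Triple T' using () renaming (P to P'; Q to Q')
        S : Triple m ℓm n
        S = triple (P ⊕ P') (Q ⊕ Q') pf qf (sumFun m ℓm n T T') iso
    D-resp-~K (K-comp P Q R pf qf qf' rf α αi β βi) =
      ≈[mod·]-trans (≈⇒≈[mod·] (Ω-++ Ω-refl D-[ T₂ ]))
        (≈[mod·]-trans (∙-cong-≈[mod·] (≈[mod·]-refl {x = Dₜ T₁}) (Dₜ≈D-formula T₂ (grassmannᵠ T₁) (grassmannᵠ T₂)))
          (≈⇒≈[mod·] (Ω-trans (Ω-sym (D-formula-comp P Q R pf qf qf' rf α αi β βi (grassmannᴾ T₁) (grassmannᵠ T₁) (grassmannᵠ T₂)))
                              (Ω-sym D-[ T₃ ]))))
      where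
        T₁ T₂ T₃ : Triple m ℓm n
        T₁ = triple P Q pf qf α αi
        T₂ = triple Q R qf' rf β βi
        T₃ = triple P R pf rf (λ x → β (α x)) (Comp.isModuleIsomorphism (Module.≈ᴹ-trans (power n R)) αi βi)

open import Data.Product using (_×_)

mainTheorem2 : ∀ {ck ℓk c ℓ : Level}
    (k : CommutativeRing ck ℓk) (A : CommutativeRing c ℓ)
    (ι : CommutativeRing.Carrier k → CommutativeRing.Carrier A) →
    RingMorphisms.IsRingHomomorphism (CommutativeRing.rawRing k) (CommutativeRing.rawRing A) ι →
    (m ℓm : Level) (n : ℕ) → 2 ≤ n →
    let open KD k A ι in
    Σ (K1C m ℓm n → ΩC) λ D →
      (∀ x y → _~K_ m ℓm n x y → D x ≈[mod n ] D y) ×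
      (∀ x y → D (x ++ y) ≈[mod n ] (D x ++ D y)) ×
      (∀ (T : Triple m ℓm n) (∇ : Connection (Triple.P T)) (∇' : Connection (Triple.Q T)) →
         D ([_] m ℓm n T) ≈[mod n ] D-formula m ℓm n T ∇ ∇')
mainTheorem2 k A ι _ m ℓm n _ =
    D
  , (λ xs ys xs~ys → ≈[mod·]⇒≈[mod] (D-resp-~K xs~ys))
  , (λ xs ys → ≈[mod·]⇒≈[mod] (≈⇒≈[mod·] {n = n} (D-++ xs ys)))
  , (λ T C C' → ≈[mod·]⇒≈[mod] (D-[]≈D-formula T C C'))
  where
    open Dlog k A ι using (≈[mod·]⇒≈[mod]; ≈⇒≈[mod·])
    open Dlog.Triples k A ι m ℓm n
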